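{- Let $n\geq 7$ and let $T$ be any chemical tree on $n$ vertices. Then \[ZC_{1}^{*}(T)\leq \begin{cases} 10(n-4) & \text{if } n\equiv 0 \pmod 3 \text{ or } n\equiv 1 \pmod 3,\\ 2(5n-19) & \text{otherwise.} \end{cases}\] Equality in the first case holds if and only if either $n\equiv 0\pmod 3$ and $T$ has exactly one vertex of degree $2$, this vertex has a pendent neighbor, and all other vertices have degree $1$ or $4$; or $n\equiv 1\pmod 3$ and $T$ has exactly one vertex of degree $3$, this vertex has two pendent neighbors, and all other vertices have degree $1$ or $4$. Equality in the second case holds if and only if $n\equiv 2\pmod 3$ and every vertex of $T$ has degree $1$ or $4$.
   Context: A chemical tree is a tree in which every vertex has degree at most $4$; a pendent vertex is a vertex of degree $1$. For a vertex $v$ of a graph $G$, $d_v$ denotes its degree and $\tau_v$ denotes the number of vertices at distance exactly $2$ from $v$. The modified first Zagreb connection index is $ZC_{1}^{*}(G)=\sum_{v\in V(G)}d_{v}\tau_{v}$. -}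

module Defs where

open import Data.Nat using (ℕ; zero; suc; _+_; _*_; _≤_)
open import Data.Fin using (Fin; zero; suc)
open import Data.Bool using (Bool; true; false; if_then_else_; _∧_; _∨_; not)
open import Data.List using (List; []; _∷_; length)
open import Data.List.Relation.Unary.Unique.Propositional using (Unique)
open import Data.Product using (Σ; _×_; ∃)
open import Relation.Binary.PropositionalEquality using (_≡_)
open import Relation.Nullary using (¬_)
open import Relation.Nullary.Decidable using (⌊_⌋)
open import Data.Fin.Properties using () renaming (_≟_ to _≟ᶠ_)

sumFin : {n : ℕ} → (Fin n → ℕ) → ℕ
sumFin {zero}  f = 0
sumFin {suc n} f = f zero + sumFin (λ i → f (suc i))

anyFin : {n : ℕ} → (Fin n → Bool) → Bool
anyFin {zero}  f = false
anyFin {suc n} f = f zero ∨ anyFin (λ i → f (suc i))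

countFin : {n : ℕ} → (Fin n → Bool) → ℕ
countFin f = sumFin (λ i → if f i then 1 else 0)

record Graph (n : ℕ) : Set where
  field
    adj    : Fin n → Fin n → Bool
    sym    : ∀ i j → adj i j ≡ adj j i
    irrefl : ∀ i → adj i i ≡ false
open Graph public

module _ {n : ℕ} (G : Graph n) where

  Adj : Fin n → Fin n → Set
  Adj i j = adj G i j ≡ true

  deg : Fin n → ℕ
  deg v = countFin (adj G v)

  dist2 : Fin n → Fin n → Bool
  dist2 v u = not ⌊ v ≟ᶠ u ⌋ ∧ not (adj G v u) ∧ anyFin (λ w → adj G v w ∧ adj G w u)

  tau : Fin n → ℕ
  tau v = countFin (dist2 v)

  ZC1* : ℕ
  ZC1* = sumFin (λ v → deg v * tau v)

  data Walk : Fin n → Fin n → Set where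
    here : ∀ {i} → Walk i i
    step : ∀ {i j k} → Adj i j → Walk j k → Walk i k

  Connected : Set
  Connected = ∀ i j → Walk i j

  ChainTo : Fin n → Fin n → List (Fin n) → Set
  ChainTo x v []       = Adj v x
  ChainTo x v (w ∷ vs) = Adj v w × ChainTo x w vs

  IsCycle : Fin n → List (Fin n) → Set
  IsCycle v₀ vs = 2 ≤ length vs × Unique (v₀ ∷ vs) × ChainTo v₀ v₀ vs

  Acyclic : Set
  Acyclic = ∀ v₀ vs → ¬ IsCycle v₀ vs

  IsTree : Set
  IsTree = Connected × Acyclic

  IsChemical : Set
  IsChemical = ∀ v → deg v ≤ 4

  Pendent : Fin n → Set
  Pendent v = deg v ≡ 1

  pendentNbrs : Fin n → ℕ
  pendentNbrs v = countFin (λ u → adj G v u ∧ ⌊ deg u Data.Nat.≟ 1 ⌋)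

module Submission where

open import Defs
open import Data.Nat using (ℕ; _+_; _*_; _∸_; _≤_; _≥_; _%_)
open import Data.Fin using (Fin)
open import Data.Product using (_×_; ∃)
open import Data.Sum using (_⊎_)
open import Function.Bundles using (_⇔_)
open import Relation.Nullary using (¬_)
open import Relation.Binary.PropositionalEquality using (_≡_; _≢_)

open import Data.Bool using (Bool; true; false; if_then_else_; _∧_; _∨_; not)
open import Data.Bool.Properties using (¬-not; ∧-zeroʳ; ∧-idem; ∧-identityʳ; ∨-zeroʳ; ∨-comm) renaming (_≟_ to _≟ᵇ_)
open import Data.Empty using (⊥; ⊥-elim)
open import Data.Fin using (zero; suc; fromℕ<)
open import Data.Fin.Properties using (any?; toℕ<n; pigeonhole) renaming (_≟_ to _≟ᶠ_; suc-injective to Fin-suc-injective; <⇒≢ to <⇒≢ᶠ)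
open import Data.List using (List; []; _∷_; length; lookup; _++_)
import Data.List.Relation.Unary.All as All
open import Data.List.Relation.Unary.All using ([]; _∷_)
open import Data.List.Relation.Unary.All.Properties using (++⁻; ¬Any⇒All¬)
open import Data.List.Relation.Unary.AllPairs using ([]; _∷_)
open import Data.List.Relation.Unary.Any using (here; there)
open import Data.List.Relation.Unary.Unique.Propositional using (Unique)
open import Data.List.Membership.Propositional using (_∈_)
open import Data.List.Membership.Propositional.Properties using (∈-lookup; ∈-∃++)
open import Data.Nat using (zero; suc; _<_; _≤?_; _≟_; z≤n; s≤s)
open import Data.Nat.DivMod using ([m+kn]%n≡m%n)
open import Data.Nat.Properties
open import Algebra.Properties.Semiring.Sum +-*-semiring using (sum; ∑-distrib-+; ∑-comm; *-distribˡ-sum)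
open import Data.Nat.Tactic.RingSolver using (solve-∀)
open import Data.Product using (_,_; proj₁; proj₂)
open import Data.Sum using (inj₁; inj₂; [_,_]′)
open import Data.Unit using (⊤; tt)
open import Function.Base using (_∘_)
open import Function.Bundles using (mk⇔)
open import Function.Construct.Composition using (_⇔-∘_)
open import Relation.Nullary using (Dec; yes; no; ¬?; contradiction)
open import Relation.Nullary.Decidable using (⌊_⌋; True; toWitness; _×-dec_; _→-dec_; decidable-stable)
open import Relation.Unary using (Decidable)
open import Relation.Binary.PropositionalEquality as ≡ using (refl; cong; cong₂; subst; subst₂; trans)

-- The bound is proved by discharging.  A non-pendent vertex gets a type recording its degree d
-- and its number k of pendent neighbours, and an edge between non-pendent vertices of types s, t
-- a defect Q s t = γ s + γ t − 6 d_s d_t ≥ 0 (γ a fixed table); the total defect is 0 iff all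
-- degrees are 1 or 4.  In a tree τ_v = Σ_{w ~ v} (d_w − 1), so 6 · ZC₁* is a sum of charges
-- over ordered edges; moving a suitable flow along the edges makes every vertex balance exactly,
-- and with the handshake identity Σ d_v = 2(n − 1) this gives the main identity
--     6 · ZC₁*(T) + (total defect) + 228 = 60 n.
-- The corollary then reduces to locating the total defect: it is at least 12 as soon as some
-- non-pendent vertex has degree ≠ 4, and equal to 12 exactly for the two extremal shapes.

𝟙 : Bool → ℕ
𝟙 b = if b then 1 else 0

_==_ : ∀ {n} → Fin n → Fin n → Bool
i == j = ⌊ i ≟ᶠ j ⌋

==-refl : ∀ {n} (i : Fin n) → (i == i) ≡ true
==-refl i with i ≟ᶠ i
... | yes _   = refl
... | no i≢i = ⊥-elim (i≢i refl)

==-≢ : ∀ {n} {i j : Fin n} → i ≢ j → (i == j) ≡ false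
==-≢ {i = i} {j} i≢j with i ≟ᶠ j
... | yes i≡j = ⊥-elim (i≢j i≡j)
... | no _    = refl

not-==⇒≢ : ∀ {n} {i j : Fin n} → not (i == j) ≡ true → i ≢ j
not-==⇒≢ {i = i} i≠j refl = contradiction (trans (cong not (≡.sym (==-refl i))) i≠j) λ ()

suc==suc : ∀ {n} (i j : Fin n) → (suc i == suc j) ≡ (i == j)
suc==suc i j with i ≟ᶠ j | suc i ≟ᶠ suc j
... | yes _   | yes _     = refl
... | no _    | no _      = refl
... | yes i≡j | no si≢sj  = ⊥-elim (si≢sj (cong suc i≡j))
... | no i≢j  | yes si≡sj = ⊥-elim (i≢j (Fin-suc-injective si≡sj))

sumFin≡sum : ∀ {n} (f : Fin n → ℕ) → sumFin f ≡ sum f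
sumFin≡sum {zero}  f = refl
sumFin≡sum {suc n} f = cong (f zero +_) (sumFin≡sum (f ∘ suc))

sum-cong : ∀ {n} {f g : Fin n → ℕ} → (∀ i → f i ≡ g i) → sumFin f ≡ sumFin g
sum-cong {zero}  eq = refl
sum-cong {suc n} eq = cong₂ _+_ (eq zero) (sum-cong (eq ∘ suc))

sum-+ : ∀ {n} (f g : Fin n → ℕ) → sumFin (λ i → f i + g i) ≡ sumFin f + sumFin g
sum-+ f g = begin
  sumFin (λ i → f i + g i)   ≡⟨ sumFin≡sum (λ i → f i + g i) ⟩
  sum (λ i → f i + g i)      ≡⟨ ∑-distrib-+ f g ⟩
  sum f + sum g              ≡⟨ cong₂ _+_ (sumFin≡sum f) (sumFin≡sum g) ⟨
  sumFin f + sumFin g        ∎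
  where open ≡.≡-Reasoning

sum-* : ∀ {n} (c : ℕ) (f : Fin n → ℕ) → sumFin (λ i → c * f i) ≡ c * sumFin f
sum-* c f = begin
  sumFin (λ i → c * f i)   ≡⟨ sumFin≡sum (λ i → c * f i) ⟩
  sum (λ i → c * f i)      ≡⟨ *-distribˡ-sum c f ⟨
  c * sum f                ≡⟨ cong (c *_) (sumFin≡sum f) ⟨
  c * sumFin f             ∎
  where open ≡.≡-Reasoning

sum-swap : ∀ {m n} (f : Fin m → Fin n → ℕ) →
  sumFin (λ i → sumFin (f i)) ≡ sumFin (λ j → sumFin (λ i → f i j))
sum-swap f = begin
  sumFin (λ i → sumFin (f i))            ≡⟨ sum-cong (λ i → sumFin≡sum (f i)) ⟩
  sumFin (λ i → sum (f i))               ≡⟨ sumFin≡sum (λ i → sum (f i)) ⟩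
  sum (λ i → sum (f i))                  ≡⟨ ∑-comm f ⟩
  sum (λ j → sum (λ i → f i j))          ≡⟨ sumFin≡sum (λ j → sum (λ i → f i j)) ⟨
  sumFin (λ j → sum (λ i → f i j))       ≡⟨ sum-cong (λ j → sumFin≡sum (λ i → f i j)) ⟨
  sumFin (λ j → sumFin (λ i → f i j))    ∎
  where open ≡.≡-Reasoning

sum-const : ∀ n (c : ℕ) → sumFin {n} (λ _ → c) ≡ n * c
sum-const zero    c = refl
sum-const (suc n) c = cong (c +_) (sum-const n c)

sum-zero : ∀ {n} {f : Fin n → ℕ} → (∀ i → f i ≡ 0) → sumFin f ≡ 0
sum-zero {n} eq = trans (sum-cong eq) (trans (sum-const n 0) (*-zeroʳ n))

sum-mono : ∀ {n} {f g : Fin n → ℕ} → (∀ i → f i ≤ g i) → sumFin f ≤ sumFin g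
sum-mono {zero}  le = z≤n
sum-mono {suc n} le = +-mono-≤ (le zero) (sum-mono (le ∘ suc))

only : ∀ {n} → Fin n → (Fin n → ℕ) → Fin n → ℕ
only j f i = if i == j then f i else 0

sum-point : ∀ {n} (j : Fin n) (f : Fin n → ℕ) → sumFin (only j f) ≡ f j
sum-point {suc n} zero    f = trans (cong (f zero +_) (sum-zero {n} (λ i → refl))) (+-identityʳ _)
sum-point {suc n} (suc j) f =
  trans (sum-cong (λ i → cong (λ b → if b then f (suc i) else 0) (suc==suc i j))) (sum-point j (f ∘ suc))

sum-≥-one : ∀ {n} (f : Fin n → ℕ) i → f i ≤ sumFin f
sum-≥-one f i = subst (_≤ sumFin f) (sum-point i f) (sum-mono at-i)
  where
  at-i : ∀ k → only i f k ≤ f k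
  at-i k with k ≟ᶠ i
  ... | yes _ = ≤-refl
  ... | no _  = z≤n

sum-≥-two : ∀ {n} (f : Fin n → ℕ) {i j} → i ≢ j → f i + f j ≤ sumFin f
sum-≥-two f {i} {j} i≢j = subst (_≤ sumFin f) split (sum-mono at-ij)
  where
  at-ij : ∀ k → only i f k + only j f k ≤ f k
  at-ij k with k ≟ᶠ i | k ≟ᶠ j
  ... | yes refl | yes refl = ⊥-elim (i≢j refl)
  ... | yes _    | no _     = ≤-reflexive (+-identityʳ _)
  ... | no _     | yes _    = ≤-refl
  ... | no _     | no _     = z≤n
  split : sumFin (λ k → only i f k + only j f k) ≡ f i + f j
  split = trans (sum-+ (only i f) (only j f)) (cong₂ _+_ (sum-point i f) (sum-point j f))

sum-≥-three : ∀ {n} (f : Fin n → ℕ) {i j k} → i ≢ j → i ≢ k → j ≢ k → f i + f j + f k ≤ sumFin f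
sum-≥-three f {i} {j} {k} i≢j i≢k j≢k = subst (_≤ sumFin f) split (sum-mono at-ijk)
  where
  at-ijk : ∀ l → only i f l + only j f l + only k f l ≤ f l
  at-ijk l with l ≟ᶠ i | l ≟ᶠ j | l ≟ᶠ k
  ... | yes refl | yes refl | _        = ⊥-elim (i≢j refl)
  ... | yes refl | no _     | yes refl = ⊥-elim (i≢k refl)
  ... | no _     | yes refl | yes refl = ⊥-elim (j≢k refl)
  ... | yes _    | no _     | no _     = ≤-reflexive (trans (+-identityʳ _) (+-identityʳ _))
  ... | no _     | yes _    | no _     = ≤-reflexive (+-identityʳ _)
  ... | no _     | no _     | yes _    = ≤-refl
  ... | no _     | no _     | no _     = z≤n
  split : sumFin (λ l → only i f l + only j f l + only k f l) ≡ f i + f j + f k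
  split = trans (sum-+ (λ l → only i f l + only j f l) (only k f))
    (cong₂ _+_ (trans (sum-+ (only i f) (only j f)) (cong₂ _+_ (sum-point i f) (sum-point j f)))
               (sum-point k f))

sum≡0⇒term≡0 : ∀ {n} (f : Fin n → ℕ) → sumFin f ≡ 0 → ∀ i → f i ≡ 0
sum≡0⇒term≡0 f sum≡0 i = n≤0⇒n≡0 (subst (f i ≤_) sum≡0 (sum-≥-one f i))

count-≥1 : ∀ {n} (p : Fin n → Bool) {i} → p i ≡ true → 1 ≤ countFin p
count-≥1 p {i} pi = subst (λ b → 𝟙 b ≤ countFin p) pi (sum-≥-one (𝟙 ∘ p) i)

count-≥2 : ∀ {n} (p : Fin n → Bool) {i j} → i ≢ j → p i ≡ true → p j ≡ true → 2 ≤ countFin p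
count-≥2 p i≢j pi pj =
  subst₂ (λ a b → 𝟙 a + 𝟙 b ≤ countFin p) pi pj (sum-≥-two (𝟙 ∘ p) i≢j)

count-≥3 : ∀ {n} (p : Fin n → Bool) {i j k} → i ≢ j → i ≢ k → j ≢ k →
  p i ≡ true → p j ≡ true → p k ≡ true → 3 ≤ countFin p
count-≥3 p {i} {j} {k} i≢j i≢k j≢k pi pj pk =
  subst (_≤ countFin p) ones (sum-≥-three (𝟙 ∘ p) i≢j i≢k j≢k)
  where
  ones : 𝟙 (p i) + 𝟙 (p j) + 𝟙 (p k) ≡ 3
  ones rewrite pi | pj | pk = refl

∧-true : ∀ {a b} → (a ∧ b) ≡ true → a ≡ true × b ≡ true
∧-true {true} {true} _ = refl , refl

count-witness : ∀ {n} (p : Fin n → Bool) → 1 ≤ countFin p → ∃ λ i → p i ≡ true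
count-witness p 1≤count with any? (λ i → p i ≟ᵇ true)
... | yes witness = witness
... | no none = contradiction (subst (1 ≤_) (sum-zero all-false) 1≤count) λ ()
  where
  all-false : ∀ i → 𝟙 (p i) ≡ 0
  all-false i = cong 𝟙 (¬-not (λ pi → none (i , pi)))

count-witness-avoiding : ∀ {n} (p : Fin n → Bool) → 2 ≤ countFin p → ∀ s →
  ∃ λ y → p y ≡ true × y ≢ s
count-witness-avoiding {n} p 2≤count s = avoiding (count-witness p′ (≤-pred (subst (2 ≤_) (+-comm (countFin p′) 1) bound)))
  where
  p′ : Fin n → Bool
  p′ y = p y ∧ not (y == s)
  avoiding : (∃ λ y → p′ y ≡ true) → ∃ λ y → p y ≡ true × y ≢ s
  avoiding (y , p′y) = y , proj₁ (∧-true p′y) , not-==⇒≢ (proj₂ (∧-true p′y))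
  split : ∀ y → 𝟙 (p y) ≤ 𝟙 (p′ y) + only s (λ _ → 1) y
  split y with p y | y ≟ᶠ s
  ... | false | _     = z≤n
  ... | true  | yes _ = ≤-reflexive refl
  ... | true  | no _  = ≤-reflexive (≡.sym (+-identityʳ 1))
  bound : 2 ≤ countFin p′ + 1
  bound = ≤-trans 2≤count (≤-trans (sum-mono split)
    (≤-reflexive (trans (sum-+ (𝟙 ∘ p′) (only s (λ _ → 1))) (cong (countFin p′ +_) (sum-point s (λ _ → 1))))))

count-≤1 : ∀ {n} (p : Fin n → Bool) (w₀ : Fin n) → (∀ w → p w ≡ true → w ≡ w₀) → countFin p ≤ 1
count-≤1 p w₀ only-w₀ = ≤-trans (sum-mono below) (≤-reflexive (sum-point w₀ (λ _ → 1)))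
  where
  below : ∀ w → 𝟙 (p w) ≤ only w₀ (λ _ → 1) w
  below w with p w in pw | w ≟ᶠ w₀
  ... | false | _       = z≤n
  ... | true  | yes _   = ≤-refl
  ... | true  | no w≢w₀ = contradiction (only-w₀ w pw) w≢w₀

anyFin-intro : ∀ {n} (p : Fin n → Bool) {i} → p i ≡ true → anyFin p ≡ true
anyFin-intro p {zero}  pi rewrite pi = refl
anyFin-intro p {suc i} pi rewrite anyFin-intro (p ∘ suc) pi = ∨-zeroʳ (p zero)

anyFin-none : ∀ {n} (p : Fin n → Bool) → (∀ i → p i ≡ false) → anyFin p ≡ false
anyFin-none {zero}  p none = refl
anyFin-none {suc n} p none rewrite none zero = anyFin-none (p ∘ suc) (none ∘ suc)

lookup-injective : ∀ {A : Set} {xs : List A} → Unique xs → ∀ i j → lookup xs i ≡ lookup xs j → i ≡ j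
lookup-injective (_ ∷ _)     zero    zero    _ = refl
lookup-injective (x∉ ∷ _)    zero    (suc j) e = contradiction e (All.lookup x∉ (∈-lookup j))
lookup-injective (x∉ ∷ _)    (suc i) zero    e = contradiction (≡.sym e) (All.lookup x∉ (∈-lookup i))
lookup-injective (_ ∷ uniq)  (suc i) (suc j) e = cong suc (lookup-injective uniq i j e)

unique-length : ∀ {n} (xs : List (Fin n)) → Unique xs → length xs ≤ n
unique-length {n} xs uniq with length xs ≤? n
... | yes short = short
... | no long with pigeonhole (≰⇒> long) (lookup xs)
...   | i , j , i<j , same = contradiction (lookup-injective uniq i j same) (<⇒≢ᶠ i<j)

unique-prefix : ∀ {A : Set} pre (y : A) post → Unique (pre ++ y ∷ post) → Unique (y ∷ pre)
unique-prefix []        y post _            = [] ∷ []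
unique-prefix (x ∷ pre) y post (x∉ ∷ uniq) with unique-prefix pre y post uniq | ++⁻ pre x∉
... | y∉pre ∷ uniq-pre | x∉pre , (x≢y ∷ _) = ((x≢y ∘ ≡.sym) ∷ y∉pre) ∷ x∉pre ∷ uniq-pre

module GraphFacts {n : ℕ} (G : Graph n) where

  open import Data.List.Membership.DecPropositional (_≟ᶠ_ {n}) using (_∈?_)

  a : Fin n → Fin n → Bool
  a = adj G

  Adj-sym : ∀ {v w} → Adj G v w → Adj G w v
  Adj-sym {v} {w} v~w = trans (sym G w v) v~w

  Adj-irrefl : ∀ {v w} → Adj G v w → v ≢ w
  Adj-irrefl {v} v~v refl = contradiction (trans (≡.sym v~v) (irrefl G v)) λ ()

  leaf-nbr-unique : ∀ {v x y} → deg G v ≡ 1 → Adj G v x → Adj G v y → x ≡ y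
  leaf-nbr-unique {v} {x} {y} d≡1 v~x v~y with x ≟ᶠ y
  ... | yes x≡y = x≡y
  ... | no x≢y  = contradiction (subst (2 ≤_) d≡1 (count-≥2 (a v) x≢y v~x v~y)) λ { (s≤s ()) }

  deg2-nbrs : ∀ {v x y z} → deg G v ≡ 2 → Adj G v x → Adj G v y → x ≢ y → Adj G v z → z ≡ x ⊎ z ≡ y
  deg2-nbrs {v} {x} {y} {z} d≡2 v~x v~y x≢y v~z with z ≟ᶠ x | z ≟ᶠ y
  ... | yes z≡x | _       = inj₁ z≡x
  ... | no _    | yes z≡y = inj₂ z≡y
  ... | no z≢x  | no z≢y  =
    contradiction (subst (3 ≤_) d≡2 (count-≥3 (a v) x≢y (z≢x ∘ ≡.sym) (z≢y ∘ ≡.sym) v~x v~y v~z))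
                  λ { (s≤s (s≤s ())) }

  closure : Connected G → (P : Fin n → Set) → ∀ {z₀} → P z₀ → (∀ {x y} → P x → Adj G x y → P y) → ∀ z → P z
  closure connected P {z₀} Pz₀ inherit z = along (connected z₀ z) Pz₀
    where
    along : ∀ {i j} → Walk G i j → P i → P j
    along here         Pi = Pi
    along (step i~j w) Pi = along w (inherit Pi i~j)

  no-triangle : Acyclic G → ∀ {v w u} → Adj G v w → Adj G w u → Adj G v u → ⊥
  no-triangle acyclic {v} {w} {u} v~w w~u v~u = acyclic v (w ∷ u ∷ [])
    ( s≤s (s≤s z≤n)
    , (Adj-irrefl v~w ∷ Adj-irrefl v~u ∷ []) ∷ (Adj-irrefl w~u ∷ []) ∷ [] ∷ []
    , v~w , w~u , Adj-sym v~u )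

  no-square : Acyclic G → ∀ {v w w′ u} → v ≢ u → w ≢ w′ →
    Adj G v w → Adj G w u → Adj G v w′ → Adj G w′ u → ⊥
  no-square acyclic {v} {w} {w′} {u} v≢u w≢w′ v~w w~u v~w′ w′~u = acyclic v (w ∷ u ∷ w′ ∷ [])
    ( s≤s (s≤s z≤n)
    , (Adj-irrefl v~w ∷ v≢u ∷ Adj-irrefl v~w′ ∷ []) ∷ (Adj-irrefl w~u ∷ w≢w′ ∷ [])
        ∷ ((Adj-irrefl w′~u ∘ ≡.sym) ∷ []) ∷ [] ∷ []
    , v~w , w~u , Adj-sym w′~u , Adj-sym v~w′ )

  common : Fin n → Fin n → ℕ
  common v u = countFin (λ w → a v w ∧ a w u)

  common≡dist2 : Acyclic G → ∀ {v u} → v ≢ u → common v u ≡ 𝟙 (dist2 G v u)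
  common≡dist2 acyclic {v} {u} v≢u rewrite ==-≢ v≢u with a v u in v~u
  ... | true = sum-zero none
    where
    none : ∀ w → 𝟙 (a v w ∧ a w u) ≡ 0
    none w with a v w in v~w | a w u in w~u
    ... | true  | true  = ⊥-elim (no-triangle acyclic v~w w~u v~u)
    ... | true  | false = refl
    ... | false | _     = refl
  ... | false with any? (λ w → (a v w ∧ a w u) ≟ᵇ true)
  ...   | yes (w₀ , w₀-common) rewrite anyFin-intro (λ w → a v w ∧ a w u) w₀-common =
          ≤-antisym (count-≤1 _ w₀ unique) (count-≥1 (λ w → a v w ∧ a w u) w₀-common)
    where
    unique : ∀ w → (a v w ∧ a w u) ≡ true → w ≡ w₀
    unique w w-common with w ≟ᶠ w₀
    ... | yes w≡w₀ = w≡w₀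
    ... | no w≢w₀  = ⊥-elim (no-square acyclic v≢u w≢w₀ (proj₁ (∧-true w-common)) (proj₂ (∧-true w-common))
                                                       (proj₁ (∧-true w₀-common)) (proj₂ (∧-true w₀-common)))
  ...   | no none rewrite anyFin-none (λ w → a v w ∧ a w u) (λ w → ¬-not (λ c → none (w , c))) =
          sum-zero (λ w → cong 𝟙 (¬-not (λ c → none (w , c))))

  common-self : ∀ v → common v v ≡ deg G v
  common-self v = sum-cong (λ w → cong 𝟙 (trans (cong (a v w ∧_) (sym G w v)) (∧-idem (a v w))))

  tau+deg : Acyclic G → ∀ v → tau G v + deg G v ≡ sumFin (λ w → if a v w then deg G w else 0)
  tau+deg acyclic v = ≡.sym (begin
    sumFin (λ w → if a v w then deg G w else 0)              ≡⟨ sum-cong expand ⟩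
    sumFin (λ w → sumFin (λ u → 𝟙 (a v w ∧ a w u)))          ≡⟨ sum-swap (λ w u → 𝟙 (a v w ∧ a w u)) ⟩
    sumFin (common v)                                        ≡⟨ sum-cong split ⟩
    sumFin (λ u → 𝟙 (dist2 G v u) + only v (common v) u)     ≡⟨ sum-+ (λ u → 𝟙 (dist2 G v u)) (only v (common v)) ⟩
    tau G v + sumFin (only v (common v))                     ≡⟨ cong (tau G v +_) (sum-point v (common v)) ⟩
    tau G v + common v v                                     ≡⟨ cong (tau G v +_) (common-self v) ⟩
    tau G v + deg G v                                        ∎)
    where
    open ≡.≡-Reasoning
    expand : ∀ w → (if a v w then deg G w else 0) ≡ sumFin (λ u → 𝟙 (a v w ∧ a w u))
    expand w with a v w
    ... | true  = refl
    ... | false = ≡.sym (sum-zero {n} (λ _ → refl))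
    split : ∀ u → common v u ≡ 𝟙 (dist2 G v u) + only v (common v) u
    split u with u ≟ᶠ v
    ... | yes refl rewrite ==-refl v = refl
    ... | no u≢v   = trans (common≡dist2 acyclic (u≢v ∘ ≡.sym)) (≡.sym (+-identityʳ _))

  tau-formula : Acyclic G → ∀ v → tau G v ≡ sumFin (λ w → if a v w then deg G w ∸ 1 else 0)
  tau-formula acyclic v = +-cancelʳ-≡ (deg G v) _ _ (begin
    tau G v + deg G v                                         ≡⟨ tau+deg acyclic v ⟩
    sumFin (λ w → if a v w then deg G w else 0)               ≡⟨ sum-cong peel ⟩
    sumFin (λ w → (if a v w then deg G w ∸ 1 else 0) + 𝟙 (a v w))
                                   ≡⟨ sum-+ (λ w → if a v w then deg G w ∸ 1 else 0) (𝟙 ∘ a v) ⟩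
    sumFin (λ w → if a v w then deg G w ∸ 1 else 0) + deg G v ∎)
    where
    open ≡.≡-Reasoning
    peel : ∀ w → (if a v w then deg G w else 0) ≡ (if a v w then deg G w ∸ 1 else 0) + 𝟙 (a v w)
    peel w with a v w in v~w
    ... | true  = ≡.sym (m∸n+n≡m (count-≥1 (a w) (Adj-sym v~w)))
    ... | false = refl

  VertexSet : Set
  VertexSet = Fin n → Bool

  size : VertexSet → ℕ
  size S = countFin S

  degIn : VertexSet → Fin n → ℕ
  degIn S x = countFin (λ w → S w ∧ a x w)

  -- twice the number of edges with both ends in S
  edges2 : VertexSet → ℕ
  edges2 S = sumFin (λ v → if S v then degIn S v else 0)

  insert : Fin n → VertexSet → VertexSet
  insert x S z = (z == x) ∨ S z

  degIn-insert : ∀ S {x} → S x ≡ false → ∀ v → degIn (insert x S) v ≡ degIn S v + 𝟙 (a v x)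
  degIn-insert S {x} x∉S v = trans (sum-cong split)
    (trans (sum-+ (λ w → 𝟙 (S w ∧ a v w)) (only x (𝟙 ∘ a v))) (cong (degIn S v +_) (sum-point x (𝟙 ∘ a v))))
    where
    split : ∀ w → 𝟙 (insert x S w ∧ a v w) ≡ 𝟙 (S w ∧ a v w) + only x (𝟙 ∘ a v) w
    split w with w ≟ᶠ x
    ... | yes refl rewrite x∉S = refl
    ... | no _     = ≡.sym (+-identityʳ _)

  edges2-insert : ∀ S {x} → S x ≡ false → edges2 (insert x S) ≡ edges2 S + degIn S x + degIn S x
  edges2-insert S {x} x∉S = begin
    edges2 (insert x S)
      ≡⟨ sum-cong split ⟩
    sumFin (λ v → (if S v then degIn S v else 0) + 𝟙 (S v ∧ a x v) + only x (degIn S) v)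
      ≡⟨ trans (sum-+ _ (only x (degIn S))) (cong₂ _+_ (sum-+ (λ v → if S v then degIn S v else 0) (λ v → 𝟙 (S v ∧ a x v)))
                                                        (sum-point x (degIn S))) ⟩
    edges2 S + degIn S x + degIn S x ∎
    where
    open ≡.≡-Reasoning
    split : ∀ v → (if insert x S v then degIn (insert x S) v else 0)
                ≡ (if S v then degIn S v else 0) + 𝟙 (S v ∧ a x v) + only x (degIn S) v
    split v rewrite degIn-insert S x∉S v with v ≟ᶠ x
    ... | yes refl rewrite x∉S | irrefl G x = +-identityʳ _
    ... | no _ with S v
    ...   | true  = trans (cong (λ b → degIn S v + 𝟙 b) (sym G v x)) (≡.sym (+-identityʳ _))
    ...   | false = refl

  size-insert : ∀ S {x} → S x ≡ false → size (insert x S) ≡ size S + 1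
  size-insert S {x} x∉S = trans (sum-cong split) (trans (sum-+ (𝟙 ∘ S) (only x (λ _ → 1))) (cong (size S +_) (sum-point x (λ _ → 1))))
    where
    split : ∀ z → 𝟙 (insert x S z) ≡ 𝟙 (S z) + only x (λ _ → 1) z
    split z with z ≟ᶠ x
    ... | yes refl rewrite x∉S = refl
    ... | no _     = ≡.sym (+-identityʳ _)

  remove : Fin n → VertexSet → VertexSet
  remove x S z = S z ∧ not (z == x)

  insert-remove : ∀ S {x} → S x ≡ true → ∀ z → insert x (remove x S) z ≡ S z
  insert-remove S {x} x∈S z with z ≟ᶠ x
  ... | yes refl = ≡.sym x∈S
  ... | no _     = ∧-identityʳ (S z)

  remove-∉ : ∀ S x → remove x S x ≡ false
  remove-∉ S x rewrite ==-refl x = ∧-zeroʳ (S x)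

  degIn-cong : ∀ {S S′} → (∀ z → S z ≡ S′ z) → ∀ x → degIn S x ≡ degIn S′ x
  degIn-cong S≗S′ x = sum-cong (λ w → cong (λ b → 𝟙 (b ∧ a x w)) (S≗S′ w))

  edges2-cong : ∀ {S S′} → (∀ z → S z ≡ S′ z) → edges2 S ≡ edges2 S′
  edges2-cong S≗S′ = sum-cong (λ v → cong₂ (λ b d → if b then d else 0) (S≗S′ v) (degIn-cong S≗S′ v))

  size-cong : ∀ {S S′} → (∀ z → S z ≡ S′ z) → size S ≡ size S′
  size-cong S≗S′ = sum-cong (cong 𝟙 ∘ S≗S′)

  Path : List (Fin n) → Set
  Path []           = ⊤
  Path (x ∷ [])     = ⊤
  Path (x ∷ y ∷ xs) = Adj G x y × Path (y ∷ xs)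

  path-chain : ∀ y u pre post → Path (u ∷ pre ++ y ∷ post) → ChainTo G y u pre
  path-chain y u []        post (u~y , _)    = u~y
  path-chain y u (p ∷ pre) post (u~p , path) = u~p , path-chain y p pre post path

  -- If every vertex of S had two neighbours in S, a duplicate-free path in S could be extended
  -- forever: the new neighbour is either fresh or closes a cycle.  With fuel counting the number of
  -- extensions still needed to exceed n vertices, this is impossible.
  module Branching (acyclic : Acyclic G) (S : VertexSet) (branching : ∀ x → S x ≡ true → 2 ≤ degIn S x) where

    previous : Fin n → List (Fin n) → Fin n
    previous u []      = u
    previous u (p ∷ _) = p

    grow : ∀ fuel u rest → Unique (u ∷ rest) → Path (u ∷ rest) → S u ≡ true → n < length (u ∷ rest) + fuel → ⊥
    grow zero u rest uniq path u∈S too-long =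
      <-irrefl refl (≤-trans too-long (≤-trans (≤-reflexive (+-identityʳ _)) (unique-length (u ∷ rest) uniq)))
    grow (suc fuel) u rest uniq path u∈S too-long
      with count-witness-avoiding (λ w → S w ∧ a u w) (branching u u∈S) (previous u rest)
    ... | y , y∈S∧u~y , y≢prev with y ∈? (u ∷ rest)
    ...   | no y∉path = grow fuel y (u ∷ rest) (¬Any⇒All¬ (u ∷ rest) y∉path ∷ uniq) (Adj-sym u~y , path) y∈S
                          (subst (n <_) (+-suc _ fuel) too-long)
      where
      u~y : Adj G u y
      u~y = proj₂ (∧-true y∈S∧u~y)
      y∈S : S y ≡ true
      y∈S = proj₁ (∧-true y∈S∧u~y)
    ...   | yes y∈path with ∈-∃++ y∈path
    ...     | []                , post , refl = Adj-irrefl (proj₂ (∧-true y∈S∧u~y)) refl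
    ...     | (_ ∷ [])          , post , refl = y≢prev refl
    ...     | (_ ∷ p ∷ pre)     , post , refl =
              acyclic y (u ∷ p ∷ pre) ( s≤s (s≤s z≤n) , unique-prefix (u ∷ p ∷ pre) y post uniq
                                      , Adj-sym (proj₂ (∧-true y∈S∧u~y)) , path-chain y u (p ∷ pre) post path )

  leaf-in : Acyclic G → ∀ S {x₀} → S x₀ ≡ true → ∃ λ x → S x ≡ true × degIn S x ≤ 1
  leaf-in acyclic S {x₀} x₀∈S with any? (λ x → (S x ≟ᵇ true) ×-dec (degIn S x ≤? 1))
  ... | yes leaf = leaf
  ... | no none  = ⊥-elim (Branching.grow acyclic S branching (suc n) x₀ [] ([] ∷ []) tt x₀∈S (s≤s (n≤1+n n)))
    where
    branching : ∀ x → S x ≡ true → 2 ≤ degIn S x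
    branching x x∈S = ≰⇒> (λ ≤1 → none (x , x∈S , ≤1))

  degIn-mono : ∀ {S S′} → (∀ z → S z ≡ true → S′ z ≡ true) → ∀ x → degIn S x ≤ degIn S′ x
  degIn-mono {S} {S′} S⊆S′ x = sum-mono below
    where
    below : ∀ w → 𝟙 (S w ∧ a x w) ≤ 𝟙 (S′ w ∧ a x w)
    below w with S w in w∈S
    ... | false = z≤n
    ... | true rewrite S⊆S′ w w∈S = ≤-refl

  degIn-≤-size : ∀ S x → degIn S x ≤ size S
  degIn-≤-size S x = sum-mono below
    where
    below : ∀ w → 𝟙 (S w ∧ a x w) ≤ 𝟙 (S w)
    below w with S w
    ... | false = z≤n
    ... | true with a x w
    ...   | true  = ≤-refl
    ...   | false = z≤n

  edges2-≤-degree-sum : ∀ S → edges2 S ≤ sumFin (deg G)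
  edges2-≤-degree-sum S = sum-mono below
    where
    below : ∀ v → (if S v then degIn S v else 0) ≤ deg G v
    below v with S v
    ... | false = z≤n
    ... | true  = degIn-mono (λ _ _ → refl) v

  size-complement : ∀ S → size S + countFin (not ∘ S) ≡ n
  size-complement S = trans (≡.sym (sum-+ (𝟙 ∘ S) (𝟙 ∘ not ∘ S)))
                            (trans (sum-cong one) (trans (sum-const n 1) (*-identityʳ n)))
    where
    one : ∀ z → 𝟙 (S z) + 𝟙 (not (S z)) ≡ 1
    one z with S z
    ... | true  = refl
    ... | false = refl

  crossing : ∀ (S : VertexSet) {i j} → Walk G i j → S i ≡ true → S j ≡ false →
    ∃ λ x → ∃ λ y → S x ≡ true × S y ≡ false × Adj G x y
  crossing S here                   i∈S j∉S = contradiction (trans (≡.sym i∈S) j∉S) λ ()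
  crossing S (step {j = k} i~k walk) i∈S j∉S with S k in k∈S
  ... | true  = crossing S walk k∈S j∉S
  ... | false = _ , _ , i∈S , k∈S , i~k

  -- Acyclic graphs: a set of k vertices spans at most k − 1 edges (remove a leaf and induct).
  edges2-upper : Acyclic G → ∀ k S → size S ≡ k → edges2 S ≤ 2 * (k ∸ 1)
  edges2-upper acyclic zero S empty = ≤-reflexive (sum-zero none)
    where
    none : ∀ v → (if S v then degIn S v else 0) ≡ 0
    none v with S v in v∈S
    ... | false = refl
    ... | true  = contradiction (trans (cong 𝟙 (≡.sym v∈S)) (sum≡0⇒term≡0 (𝟙 ∘ S) empty v)) λ ()
  edges2-upper acyclic (suc k) S size≡ with count-witness S (≤-trans (s≤s z≤n) (≤-reflexive (≡.sym size≡)))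
  ... | x₀ , x₀∈S with leaf-in acyclic S x₀∈S
  ... | x , x∈S , leaf = begin
    edges2 S                 ≡⟨ edges2-cong (insert-remove S x∈S) ⟨
    edges2 (insert x R)      ≡⟨ edges2-insert R (remove-∉ S x) ⟩
    edges2 R + d + d         ≤⟨ +-monoˡ-≤ d (+-monoˡ-≤ d (edges2-upper acyclic k R size-R)) ⟩
    2 * (k ∸ 1) + d + d      ≤⟨ add-leaf k d (≤-trans (degIn-mono (λ z → proj₁ ∘ ∧-true) x) leaf)
                                             (subst (d ≤_) size-R (degIn-≤-size R x)) ⟩
    2 * k                    ∎
    where
    open ≤-Reasoning
    R : VertexSet
    R = remove x S
    d : ℕ
    d = degIn R x
    size-R : size R ≡ k
    size-R = suc-injective (trans (+-comm 1 (size R)) (trans (≡.sym (size-insert R (remove-∉ S x)))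
                                  (trans (size-cong (insert-remove S x∈S)) size≡)))
    add-leaf : ∀ k d → d ≤ 1 → d ≤ k → 2 * (k ∸ 1) + d + d ≤ 2 * k
    add-leaf zero    zero _ _ = z≤n
    add-leaf (suc k) zero _ _ = ≤-trans (≤-reflexive (trans (+-identityʳ _) (+-identityʳ _))) (*-monoʳ-≤ 2 (n≤1+n k))
    add-leaf (suc k) (suc zero) _ _ = ≤-reflexive (trans (+-assoc (2 * k) 1 1) (trans (+-comm (2 * k) 2) (≡.sym (*-suc 2 k))))
    add-leaf (suc k) (suc (suc d)) (s≤s ()) _

  -- Connected graphs: growing a vertex set along crossing edges shows that the whole graph
  -- has at least n − |S| more edges than S.
  edges2-lower : Connected G → ∀ {r} m S → S r ≡ true → size S + m ≡ n → edges2 S + 2 * m ≤ sumFin (deg G)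
  edges2-lower connected zero S r∈S _ = ≤-trans (≤-reflexive (+-identityʳ _)) (edges2-≤-degree-sum S)
  edges2-lower connected {r} (suc m) S r∈S total
    with count-witness (not ∘ S) (subst (1 ≤_) outside (s≤s z≤n))
    where
    outside : suc m ≡ countFin (not ∘ S)
    outside = +-cancelˡ-≡ (size S) _ _ (trans total (≡.sym (size-complement S)))
  ... | z , z∉S with crossing S (connected r z) r∈S (not-injective z∉S)
    where
    not-injective : ∀ {b} → not b ≡ true → b ≡ false
    not-injective {false} _ = refl
  ... | x , y , x∈S , y∉S , x~y = begin
    edges2 S + 2 * suc m                     ≡⟨ cong (edges2 S +_) (*-suc 2 m) ⟩
    edges2 S + (2 + 2 * m)                   ≡⟨ +-assoc (edges2 S) 2 (2 * m) ⟨
    edges2 S + 2 + 2 * m                     ≤⟨ +-monoˡ-≤ (2 * m) (≤-trans (+-monoʳ-≤ (edges2 S) (+-mono-≤ y-joins y-joins))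
                                                                   (≤-reflexive (≡.sym (+-assoc (edges2 S) _ _)))) ⟩
    edges2 S + degIn S y + degIn S y + 2 * m ≡⟨ cong (_+ 2 * m) (edges2-insert S y∉S) ⟨
    edges2 (insert y S) + 2 * m              ≤⟨ edges2-lower connected m (insert y S) r∈S⁺ total⁺ ⟩
    sumFin (deg G)                           ∎
    where
    open ≤-Reasoning
    y-joins : 1 ≤ degIn S y
    y-joins = count-≥1 (λ w → S w ∧ a y w) (cong₂ _∧_ x∈S (Adj-sym x~y))
    r∈S⁺ : insert y S r ≡ true
    r∈S⁺ rewrite r∈S = ∨-zeroʳ (r == y)
    total⁺ : size (insert y S) + m ≡ n
    total⁺ = trans (cong (_+ m) (size-insert S y∉S)) (trans (+-assoc (size S) 1 m) total)

  degree-sum : IsTree G → Fin n → sumFin (deg G) ≡ 2 * (n ∸ 1)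
  degree-sum (connected , acyclic) r = ≤-antisym upper lower
    where
    upper : sumFin (deg G) ≤ 2 * (n ∸ 1)
    upper = edges2-upper acyclic n (λ _ → true) (trans (sum-const n 1) (*-identityʳ n))
    no-loop : degIn (_== r) r ≡ 0
    no-loop = sum-zero {n} loop
      where
      loop : ∀ w → 𝟙 ((w == r) ∧ a r w) ≡ 0
      loop w with w ≟ᶠ r
      ... | yes refl rewrite irrefl G r = refl
      ... | no _     = refl
    lower : 2 * (n ∸ 1) ≤ sumFin (deg G)
    lower = subst (_≤ sumFin (deg G)) (cong (_+ 2 * (n ∸ 1)) (trans (sum-point r (degIn (_== r))) no-loop))
                  (edges2-lower connected (n ∸ 1) (_== r) (==-refl r)
                     (trans (cong (_+ (n ∸ 1)) (sum-point r (λ _ → 1))) (m+[n∸m]≡n (≤-trans (s≤s z≤n) (toℕ<n r)))))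

-- Types of the non-pendent vertices of a chemical tree: tdk has degree d and k pendent
-- neighbours (t4 covers every degree-4 vertex); 'unrealizable' is a junk value for other data.
data VType : Set where
  t20 t21 t30 t31 t32 t4 unrealizable : VType

type : ℕ → ℕ → VType
type 2 0 = t20
type 2 1 = t21
type 3 0 = t30
type 3 1 = t31
type 3 2 = t32
type 4 _ = t4
type _ _ = unrealizable

-- The degree/pendent-count pairs that occur for non-pendent vertices of a chemical tree on at
-- least seven vertices: degree 2, 3 or 4 and at least one non-pendent neighbour.
data Realizable : ℕ → ℕ → Set where
  r20 : Realizable 2 0
  r21 : Realizable 2 1
  r30 : Realizable 3 0
  r31 : Realizable 3 1
  r32 : Realizable 3 2
  r4  : ∀ {k} → k < 4 → Realizable 4 k

realizable : ∀ {d k} → 2 ≤ d → d ≤ 4 → k < d → Realizable d k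
realizable {2} {0} _ _ _ = r20
realizable {2} {1} _ _ _ = r21
realizable {3} {0} _ _ _ = r30
realizable {3} {1} _ _ _ = r31
realizable {3} {2} _ _ _ = r32
realizable {4} _ _ k<4 = r4 k<4
realizable {2} {suc (suc _)} _ _ (s≤s (s≤s ()))
realizable {3} {suc (suc (suc _))} _ _ (s≤s (s≤s (s≤s ())))
realizable {0} () _ _
realizable {1} (s≤s ()) _ _
realizable {suc (suc (suc (suc (suc _))))} _ (s≤s (s≤s (s≤s (s≤s ())))) _

tdeg : VType → ℕ
tdeg t20 = 2
tdeg t21 = 2
tdeg t30 = 3
tdeg t31 = 3
tdeg t32 = 3
tdeg t4  = 4
tdeg unrealizable = 0

type-deg : ∀ {d k} → Realizable d k → tdeg (type d k) ≡ d
type-deg r20    = refl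
type-deg r21    = refl
type-deg r30    = refl
type-deg r31    = refl
type-deg r32    = refl
type-deg (r4 _) = refl

-- The weights behind the discharging argument.  γ is a potential per vertex type; the defect
-- Q s t = γ s + γ t − 6 d_s d_t of an edge between types s and t is 0 between two degree-4
-- vertices, and β s = 2 γ s − 6 d_s is the charge a vertex of type s receives per non-pendent
-- neighbour.
γ : VType → ℕ
γ t20 = 21
γ t21 = 6
γ t30 = 38
γ t31 = 36
γ t32 = 30
γ t4  = 48
γ unrealizable = 0

β : VType → ℕ
β t = 2 * γ t ∸ 6 * tdeg t

Q : VType → VType → ℕ
Q s t = γ s + γ t ∸ 6 * tdeg s * tdeg t

Q-sym : ∀ s t → Q s t ≡ Q t s
Q-sym s t = cong₂ _∸_ (+-comm (γ s) (γ t))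
  (trans (*-assoc 6 (tdeg s) (tdeg t)) (trans (cong (6 *_) (*-comm (tdeg s) (tdeg t))) (≡.sym (*-assoc 6 (tdeg t) (tdeg s)))))

-- Finite checks: a decidable property holds for every type as soon as it holds on the list of
-- all seven types, which Agda verifies by evaluation.
allTypes : List VType
allTypes = t20 ∷ t21 ∷ t30 ∷ t31 ∷ t32 ∷ t4 ∷ unrealizable ∷ []

every-type : ∀ t → t ∈ allTypes
every-type t20 = here refl
every-type t21 = there (here refl)
every-type t30 = there (there (here refl))
every-type t31 = there (there (there (here refl)))
every-type t32 = there (there (there (there (here refl))))
every-type t4  = there (there (there (there (there (here refl)))))
every-type unrealizable = there (there (there (there (there (there (here refl))))))

for-all-types : ∀ {P : VType → Set} (P? : Decidable P) → {True (All.all? P? allTypes)} → ∀ t → P t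
for-all-types P? {ok} t = All.lookup (toWitness ok) (every-type t)

for-all-type-pairs : ∀ {P : VType → VType → Set} (P? : ∀ s t → Dec (P s t)) →
  {True (All.all? (λ s → All.all? (P? s) allTypes) allTypes)} → ∀ s t → P s t
for-all-type-pairs P? {ok} s t = All.lookup (All.lookup (toWitness ok) (every-type s)) (every-type t)

-- Types of degree 2 or 3 split into heavy ones, whose edges carry a large defect, and light
-- ones (a single non-pendent neighbour), whose defect is small but not zero.
data Heavy : VType → Set where
  h20 : Heavy t20
  h30 : Heavy t30
  h31 : Heavy t31

data Light : VType → Set where
  l21 : Light t21
  l32 : Light t32

heavy? : ∀ t → Dec (Heavy t)
heavy? t20 = yes h20
heavy? t30 = yes h30
heavy? t31 = yes h31
heavy? t21 = no λ ()
heavy? t32 = no λ ()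
heavy? t4  = no λ ()
heavy? unrealizable = no λ ()

light? : ∀ t → Dec (Light t)
light? t21 = yes l21
light? t32 = yes l32
light? t20 = no λ ()
light? t30 = no λ ()
light? t31 = no λ ()
light? t4  = no λ ()
light? unrealizable = no λ ()

is-t21? : ∀ t → Dec (t ≡ t21)
is-t21? t21 = yes refl
is-t21? t20 = no λ ()
is-t21? t30 = no λ ()
is-t21? t31 = no λ ()
is-t21? t32 = no λ ()
is-t21? t4  = no λ ()
is-t21? unrealizable = no λ ()

heavy-or-light : ∀ {d k} → Realizable d k → d ≢ 4 → Heavy (type d k) ⊎ Light (type d k)
heavy-or-light r20 _ = inj₁ h20
heavy-or-light r21 _ = inj₂ l21
heavy-or-light r30 _ = inj₁ h30
heavy-or-light r31 _ = inj₁ h31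
heavy-or-light r32 _ = inj₂ l32
heavy-or-light (r4 _) d≢4 = ⊥-elim (d≢4 refl)

heavy-inner : ∀ {d k} → Realizable d k → Heavy (type d k) → 2 ≤ d ∸ k
heavy-inner r20 _ = s≤s (s≤s z≤n)
heavy-inner r30 _ = s≤s (s≤s z≤n)
heavy-inner r31 _ = s≤s (s≤s z≤n)

light-inner : ∀ {d k} → Realizable d k → Light (type d k) → d ∸ k ≡ 1
light-inner r21 _ = refl
light-inner r32 _ = refl

t21-data : ∀ {d k} → Realizable d k → type d k ≡ t21 → d ≡ 2 × k ≡ 1
t21-data r21 _ = refl , refl

t32-data : ∀ {d k} → Realizable d k → type d k ≡ t32 → d ≡ 3 × k ≡ 2
t32-data r32 _ = refl , refl

realizableᵇ : VType → Bool
realizableᵇ unrealizable = false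
realizableᵇ _ = true

compatible : VType → VType → Bool
compatible s t = realizableᵇ s ∧ realizableᵇ t ∧ not (⌊ light? s ⌋ ∧ ⌊ light? t ⌋)

type-realizableᵇ : ∀ {d k} → Realizable d k → realizableᵇ (type d k) ≡ true
type-realizableᵇ r20    = refl
type-realizableᵇ r21    = refl
type-realizableᵇ r30    = refl
type-realizableᵇ r31    = refl
type-realizableᵇ r32    = refl
type-realizableᵇ (r4 _) = refl

compatible-intro : ∀ {d k d′ k′} → Realizable d k → Realizable d′ k′ →
  ¬ (Light (type d k) × Light (type d′ k′)) → compatible (type d k) (type d′ k′) ≡ true
compatible-intro {d} {k} {d′} {k′} r r′ not-both
  rewrite type-realizableᵇ r | type-realizableᵇ r′ with light? (type d k) | light? (type d′ k′)
... | yes l | yes l′ = ⊥-elim (not-both (l , l′))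
... | yes _ | no _   = refl
... | no _  | yes _  = refl
... | no _  | no _   = refl

pair-identity : ∀ s t → compatible s t ≡ true → 6 * tdeg s * (tdeg t ∸ 1) + Q s t + γ s ≡ γ t + β s
pair-identity = for-all-type-pairs pair?
  where
  pair? : ∀ s t → Dec (compatible s t ≡ true → 6 * tdeg s * (tdeg t ∸ 1) + Q s t + γ s ≡ γ t + β s)
  pair? s t = (compatible s t ≟ᵇ true) →-dec (_ ≟ _)

vertex-identity : ∀ {d k} → Realizable d k → (48 + 6 * d) * k + β (type d k) * (d ∸ k) + 168 ≡ 114 * d
vertex-identity r20 = refl
vertex-identity r21 = refl
vertex-identity r30 = refl
vertex-identity r31 = refl
vertex-identity r32 = refl
vertex-identity (r4 {0} _) = refl
vertex-identity (r4 {1} _) = refl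
vertex-identity (r4 {2} _) = refl
vertex-identity (r4 {3} _) = refl
vertex-identity (r4 {suc (suc (suc (suc _)))} (s≤s (s≤s (s≤s (s≤s ())))))

Q-heavy : ∀ {s} → Heavy s → ∀ t → 3 ≤ Q s t
Q-heavy h20 = for-all-types (λ t → 3 ≤? Q t20 t)
Q-heavy h30 = for-all-types (λ t → 3 ≤? Q t30 t)
Q-heavy h31 = for-all-types (λ t → 3 ≤? Q t31 t)

Q-light : ∀ {s} → Light s → Q s t4 ≡ 6
Q-light l21 = refl
Q-light l32 = refl

HeavyPairBound : VType → VType → VType → Set
HeavyPairBound s t t′ = (tdeg s ≡ 2 → ¬ (t ≡ t21 × t′ ≡ t21)) → 12 ≤ Q s t + Q s t′

heavy-pair? : ∀ s t t′ → Dec (HeavyPairBound s t t′)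
heavy-pair? s t t′ = ((tdeg s ≟ 2) →-dec ¬? (is-t21? t ×-dec is-t21? t′)) →-dec (12 ≤? Q s t + Q s t′)

Q-heavy-pair : ∀ {s} → Heavy s → ∀ t t′ → HeavyPairBound s t t′
Q-heavy-pair h20 = for-all-type-pairs (heavy-pair? t20)
Q-heavy-pair h30 = for-all-type-pairs (heavy-pair? t30)
Q-heavy-pair h31 = for-all-type-pairs (heavy-pair? t31)

light-types : ∀ {t} → Light t → t ≡ t21 ⊎ t ≡ t32
light-types l21 = inj₁ refl
light-types l32 = inj₂ refl

deg2-pendent-type : ∀ {k} → Realizable 2 k → 1 ≤ k → type 2 k ≡ t21
deg2-pendent-type r21 _ = refl

another-vertex : ∀ {n} → 2 ≤ n → (v : Fin n) → ∃ λ u → u ≢ v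
another-vertex {suc (suc _)} _ zero    = suc zero , λ ()
another-vertex {suc (suc _)} _ (suc _) = zero , λ ()
another-vertex {suc zero} (s≤s ()) zero

balance-arithmetic : ∀ {n} x → 1 ≤ n → x + 168 * n ≡ 114 * (2 * (n ∸ 1)) → x + 228 ≡ 60 * n
balance-arithmetic {suc m} x _ eq = +-cancelʳ-≡ (168 * m) _ _
  (trans (shift x m) (trans (cong (_+ 60) eq) (total m)))
  where
  shift : ∀ x m → x + 228 + 168 * m ≡ x + 168 * suc m + 60
  shift = solve-∀
  total : ∀ m → 114 * (2 * m) + 60 ≡ 60 * suc m + 168 * m
  total = solve-∀

degree-count-arithmetic : ∀ {n} q d → 1 ≤ n → 2 * (n ∸ 1) + 1 ≡ n + 3 * q + d → n ≡ d + 1 + q * 3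
degree-count-arithmetic {suc m} q d _ eq = +-cancelʳ-≡ (suc m) _ _ (trans (double m) (trans (cong (_+ 1) eq) (regroup m q d)))
  where
  double : ∀ m → suc m + suc m ≡ 2 * m + 1 + 1
  double = solve-∀
  regroup : ∀ m q d → suc m + 3 * q + d + 1 ≡ d + 1 + q * 3 + suc m
  regroup = solve-∀

module ChemicalTree {n : ℕ} (T : Graph n) (7≤n : 7 ≤ n) (tree : IsTree T) (chemical : IsChemical T) where

  open GraphFacts T

  connected : Connected T
  connected = proj₁ tree

  acyclic : Acyclic T
  acyclic = proj₂ tree

  some-vertex : Fin n
  some-vertex = fromℕ< (≤-trans (s≤s z≤n) 7≤n)

  pendent : Fin n → Bool
  pendent v = ⌊ deg T v ≟ 1 ⌋

  pendent-true : ∀ {v} → pendent v ≡ true → Pendent T v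
  pendent-true {v} _ with deg T v ≟ 1
  ... | yes d≡1 = d≡1
  pendent-true () | no _

  pendent-false : ∀ {v} → pendent v ≡ false → ¬ Pendent T v
  pendent-false {v} _ with deg T v ≟ 1
  ... | no d≢1 = d≢1
  pendent-false () | yes _

  pendent-yes : ∀ {v} → Pendent T v → pendent v ≡ true
  pendent-yes {v} d≡1 with deg T v ≟ 1
  ... | yes _   = refl
  ... | no d≢1 = contradiction d≡1 d≢1

  pendent-no : ∀ {v} → ¬ Pendent T v → pendent v ≡ false
  pendent-no {v} d≢1 with deg T v ≟ 1
  ... | yes d≡1 = contradiction d≡1 d≢1
  ... | no _    = refl

  pendent-or-inner : ∀ v → Pendent T v ⊎ ¬ Pendent T v
  pendent-or-inner v with deg T v ≟ 1
  ... | yes v-pendent = inj₁ v-pendent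
  ... | no v-inner    = inj₂ v-inner

  innerNbrs : Fin n → ℕ
  innerNbrs v = countFin (λ u → a v u ∧ not (pendent u))

  deg-split : ∀ v → deg T v ≡ pendentNbrs T v + innerNbrs v
  deg-split v = trans (sum-cong split) (sum-+ (λ u → 𝟙 (a v u ∧ pendent u)) (λ u → 𝟙 (a v u ∧ not (pendent u))))
    where
    split : ∀ u → 𝟙 (a v u) ≡ 𝟙 (a v u ∧ pendent u) + 𝟙 (a v u ∧ not (pendent u))
    split u with a v u | pendent u
    ... | true  | true  = refl
    ... | true  | false = refl
    ... | false | _     = refl

  innerNbrs≡ : ∀ v → innerNbrs v ≡ deg T v ∸ pendentNbrs T v
  innerNbrs≡ v = ≡.sym (trans (cong (_∸ pendentNbrs T v) (deg-split v)) (m+n∸m≡n (pendentNbrs T v) (innerNbrs v)))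

  has-nbr : ∀ v → ∃ λ w → Adj T v w
  has-nbr v with another-vertex (≤-trans (s≤s (s≤s z≤n)) 7≤n) v
  ... | u , u≢v = first-step (connected v u) (u≢v ∘ ≡.sym)
    where
    first-step : ∀ {i j} → Walk T i j → i ≢ j → ∃ λ w → Adj T i w
    first-step here          i≢i = contradiction refl i≢i
    first-step (step i~w _) _    = _ , i~w

  deg≥1 : ∀ v → 1 ≤ deg T v
  deg≥1 v = count-≥1 (a v) (proj₂ (has-nbr v))

  -- Counting argument behind all exclusions: if a property inherited by neighbours holds somewhere,
  -- it holds at every vertex, so n is bounded by any sum g that is positive where the property holds.
  covered : (P : Fin n → Set) (g : Fin n → ℕ) → (∀ {z} → P z → 1 ≤ g z) →
    ∀ {z₀} → P z₀ → (∀ {x y} → P x → Adj T x y → P y) → n ≤ sumFin g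
  covered P g positive Pz₀ inherit =
    ≤-trans (≤-reflexive (≡.sym (trans (sum-const n 1) (*-identityʳ n))))
            (sum-mono (λ z → positive (closure connected P Pz₀ inherit z)))

  1≤𝟙 : ∀ {v z} → Adj T v z → 1 ≤ 𝟙 (a v z)
  1≤𝟙 v~z rewrite v~z = ≤-refl

  star-bound : ∀ v → (∀ {z} → Adj T v z → Pendent T z) → n ≤ 1 + deg T v
  star-bound v leaves = subst (n ≤_) (trans (sum-+ (only v (λ _ → 1)) (𝟙 ∘ a v)) (cong (_+ deg T v) (sum-point v (λ _ → 1))))
    (covered P (λ z → only v (λ _ → 1) z + 𝟙 (a v z)) positive (inj₁ refl) inherit)
    where
    P : Fin n → Set
    P z = z ≡ v ⊎ Adj T v z
    positive : ∀ {z} → P z → 1 ≤ only v (λ _ → 1) z + 𝟙 (a v z)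
    positive (inj₁ refl) rewrite ==-refl v = s≤s z≤n
    positive (inj₂ v~z)  = ≤-trans (1≤𝟙 v~z) (m≤n+m _ _)
    inherit : ∀ {x y} → P x → Adj T x y → P y
    inherit (inj₁ refl) v~y = inj₂ v~y
    inherit (inj₂ v~x)  x~y = inj₁ (≡.sym (leaf-nbr-unique (leaves v~x) (Adj-sym v~x) x~y))

  double-star-bound : ∀ {v w} → Adj T v w → (∀ {z} → Adj T v z → z ≢ w → Pendent T z) →
    (∀ {z} → Adj T w z → z ≢ v → Pendent T z) → n ≤ deg T v + deg T w
  double-star-bound {v} {w} v~w v-leaves w-leaves = subst (n ≤_) (sum-+ (𝟙 ∘ a v) (𝟙 ∘ a w))
    (covered P (λ z → 𝟙 (a v z) + 𝟙 (a w z)) positive (inj₁ v~w) inherit)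
    where
    P : Fin n → Set
    P z = Adj T v z ⊎ Adj T w z
    positive : ∀ {z} → P z → 1 ≤ 𝟙 (a v z) + 𝟙 (a w z)
    positive (inj₁ v~z) = ≤-trans (1≤𝟙 v~z) (m≤m+n _ _)
    positive (inj₂ w~z) = ≤-trans (1≤𝟙 w~z) (m≤n+m _ _)
    inherit : ∀ {x y} → P x → Adj T x y → P y
    inherit {x} (inj₁ v~x) x~y with x ≟ᶠ w
    ... | yes refl = inj₂ x~y
    ... | no x≢w   = inj₂ (subst (Adj T w) (leaf-nbr-unique (v-leaves v~x x≢w) (Adj-sym v~x) x~y) (Adj-sym v~w))
    inherit {x} (inj₂ w~x) x~y with x ≟ᶠ v
    ... | yes refl = inj₁ x~y
    ... | no x≢v   = inj₁ (subst (Adj T v) (leaf-nbr-unique (w-leaves w~x x≢v) (Adj-sym w~x) x~y) v~w)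

  triple-star-bound : ∀ {c x y} → deg T c ≡ 2 → Adj T c x → Adj T c y → x ≢ y →
    (∀ {z} → Adj T x z → z ≢ c → Pendent T z) → (∀ {z} → Adj T y z → z ≢ c → Pendent T z) →
    n ≤ deg T c + deg T x + deg T y
  triple-star-bound {c} {x} {y} c-deg2 c~x c~y x≢y x-leaves y-leaves =
    subst (n ≤_) (trans (sum-+ (λ z → 𝟙 (a c z) + 𝟙 (a x z)) (𝟙 ∘ a y)) (cong (_+ deg T y) (sum-+ (𝟙 ∘ a c) (𝟙 ∘ a x))))
      (covered P (λ z → 𝟙 (a c z) + 𝟙 (a x z) + 𝟙 (a y z)) positive (inj₁ c~x) inherit)
    where
    P : Fin n → Set
    P z = Adj T c z ⊎ Adj T x z ⊎ Adj T y z
    positive : ∀ {z} → P z → 1 ≤ 𝟙 (a c z) + 𝟙 (a x z) + 𝟙 (a y z)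
    positive (inj₁ c~z)        = ≤-trans (1≤𝟙 c~z) (≤-trans (m≤m+n _ _) (m≤m+n _ _))
    positive {z} (inj₂ (inj₁ x~z)) = ≤-trans (1≤𝟙 x~z) (≤-trans (m≤n+m _ (𝟙 (a c z))) (m≤m+n _ _))
    positive (inj₂ (inj₂ y~z)) = ≤-trans (1≤𝟙 y~z) (m≤n+m _ _)
    through-leaf : ∀ {u z p} → Adj T c p → (∀ {z} → Adj T p z → z ≢ c → Pendent T z) → Adj T p u → Adj T u z → P z
    through-leaf {u} c~p p-leaves p~u u~z with u ≟ᶠ c
    ... | yes refl = inj₁ u~z
    ... | no u≢c   = inj₁ (subst (Adj T c) (leaf-nbr-unique (p-leaves p~u u≢c) (Adj-sym p~u) u~z) c~p)
    inherit : ∀ {u z} → P u → Adj T u z → P z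
    inherit (inj₁ c~u) u~z with deg2-nbrs c-deg2 c~x c~y x≢y c~u
    ... | inj₁ refl = inj₂ (inj₁ u~z)
    ... | inj₂ refl = inj₂ (inj₂ u~z)
    inherit (inj₂ (inj₁ x~u)) u~z = through-leaf c~x x-leaves x~u u~z
    inherit (inj₂ (inj₂ y~u)) u~z = through-leaf c~y y-leaves y~u u~z

  too-small : ∀ {m} → m ≤ 6 → n ≤ m → ⊥
  too-small m≤6 n≤m = contradiction (≤-trans 7≤n (≤-trans n≤m m≤6)) λ { (s≤s (s≤s (s≤s (s≤s (s≤s (s≤s ())))))) }

  pendent-nonadjacent : ∀ {v w} → Adj T v w → Pendent T v → Pendent T w → ⊥
  pendent-nonadjacent {v} {w} v~w v-pendent w-pendent = too-small (s≤s (s≤s z≤n))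
    (subst (n ≤_) (cong₂ _+_ v-pendent w-pendent)
      (double-star-bound v~w (λ v~z z≢w → contradiction (leaf-nbr-unique v-pendent v~z v~w) z≢w)
                             (λ w~z z≢v → contradiction (leaf-nbr-unique w-pendent w~z (Adj-sym v~w)) z≢v)))

  -- Every non-pendent vertex has a non-pendent neighbour, otherwise T is a star on at most 5 vertices.
  inner-nbr-count : ∀ v → ¬ Pendent T v → 1 ≤ innerNbrs v
  inner-nbr-count v v-inner with innerNbrs v in no-inner
  ... | suc _ = s≤s z≤n
  ... | zero  = ⊥-elim (too-small (s≤s (≤-trans (chemical v) (n≤1+n 4))) (star-bound v all-pendent))
    where
    all-pendent : ∀ {z} → Adj T v z → Pendent T z
    all-pendent {z} v~z with pendent z in z-pendent | sum≡0⇒term≡0 (λ u → 𝟙 (a v u ∧ not (pendent u))) no-inner z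
    ... | true  | _ = pendent-true z-pendent
    ... | false | none rewrite v~z = contradiction none λ ()

  inner-nbr-of : ∀ {v u} → (a v u ∧ not (pendent u)) ≡ true → Adj T v u × ¬ Pendent T u
  inner-nbr-of is-inner = proj₁ (∧-true is-inner) , pendent-false (not-true (proj₂ (∧-true is-inner)))
    where
    not-true : ∀ {b} → not b ≡ true → b ≡ false
    not-true {false} _ = refl

  inner-nbr : ∀ v → ¬ Pendent T v → ∃ λ w → Adj T v w × ¬ Pendent T w
  inner-nbr v v-inner with count-witness (λ u → a v u ∧ not (pendent u)) (inner-nbr-count v v-inner)
  ... | w , is-inner = w , inner-nbr-of is-inner

  inner-nbr-avoiding : ∀ v → 2 ≤ innerNbrs v → ∀ x → ∃ λ y → Adj T v y × ¬ Pendent T y × y ≢ x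
  inner-nbr-avoiding v 2≤inner x with count-witness-avoiding (λ u → a v u ∧ not (pendent u)) 2≤inner x
  ... | y , is-inner , y≢x = y , proj₁ (inner-nbr-of is-inner) , proj₂ (inner-nbr-of is-inner) , y≢x

  sole-inner-nbr : ∀ {v w} → innerNbrs v ≡ 1 → Adj T v w → ¬ Pendent T w →
    ∀ {z} → Adj T v z → z ≢ w → Pendent T z
  sole-inner-nbr {v} {w} one v~w w-inner {z} v~z z≢w with pendent z in z-pendent
  ... | true  = pendent-true z-pendent
  ... | false = contradiction (subst (2 ≤_) one (count-≥2 (λ u → a v u ∧ not (pendent u)) z≢w
                  (cong₂ _∧_ v~z (cong not z-pendent)) (cong₂ _∧_ v~w (cong not (pendent-no w-inner)))))
                  λ { (s≤s ()) }

  realizable-at : ∀ v → ¬ Pendent T v → Realizable (deg T v) (pendentNbrs T v)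
  realizable-at v v-inner = realizable (two≤ (deg≥1 v) v-inner) (chemical v)
    (subst (pendentNbrs T v <_) (≡.sym (deg-split v)) (m<m+n _ (inner-nbr-count v v-inner)))
    where
    two≤ : ∀ {d} → 1 ≤ d → d ≢ 1 → 2 ≤ d
    two≤ {suc zero}    _ d≢1 = contradiction refl d≢1
    two≤ {suc (suc _)} _ _   = s≤s (s≤s z≤n)

  vtype : Fin n → VType
  vtype v = type (deg T v) (pendentNbrs T v)

  deg-vtype : ∀ v → ¬ Pendent T v → tdeg (vtype v) ≡ deg T v
  deg-vtype v v-inner = type-deg (realizable-at v v-inner)

  light-shape : ∀ v → ¬ Pendent T v → Light (vtype v) → innerNbrs v ≡ 1 × deg T v ≤ 3
  light-shape v v-inner light = trans (innerNbrs≡ v) (light-inner (realizable-at v v-inner) light)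
                              , subst (_≤ 3) (deg-vtype v v-inner) (light-deg light)
    where
    light-deg : ∀ {t} → Light t → tdeg t ≤ 3
    light-deg l21 = s≤s (s≤s z≤n)
    light-deg l32 = ≤-refl

  -- Two adjacent light vertices would form a double star on at most six vertices.
  light-pair-impossible : ∀ {v w} → Adj T v w → ¬ Pendent T v → ¬ Pendent T w →
    Light (vtype v) → Light (vtype w) → ⊥
  light-pair-impossible {v} {w} v~w v-inner w-inner v-light w-light with light-shape v v-inner v-light | light-shape w w-inner w-light
  ... | v-one , v≤3 | w-one , w≤3 = too-small (+-mono-≤ v≤3 w≤3)
    (double-star-bound v~w (sole-inner-nbr v-one v~w w-inner) (sole-inner-nbr w-one (Adj-sym v~w) v-inner))

  compatible-at : ∀ {v w} → Adj T v w → ¬ Pendent T v → ¬ Pendent T w → compatible (vtype v) (vtype w) ≡ true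
  compatible-at {v} {w} v~w v-inner w-inner = compatible-intro (realizable-at v v-inner) (realizable-at w w-inner)
    λ { (v-light , w-light) → light-pair-impossible v~w v-inner w-inner v-light w-light }

  nbrSum : Fin n → (Fin n → ℕ) → ℕ
  nbrSum v f = sumFin (λ w → if a v w then f w else 0)

  nbrSum-cong : ∀ v {f g : Fin n → ℕ} → (∀ {w} → Adj T v w → f w ≡ g w) → nbrSum v f ≡ nbrSum v g
  nbrSum-cong v {f} {g} eq = sum-cong pointwise
    where
    pointwise : ∀ w → (if a v w then f w else 0) ≡ (if a v w then g w else 0)
    pointwise w with a v w in v~w
    ... | true  = eq v~w
    ... | false = refl

  nbrSum-+ : ∀ v (f g : Fin n → ℕ) → nbrSum v (λ w → f w + g w) ≡ nbrSum v f + nbrSum v g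
  nbrSum-+ v f g = trans (sum-cong pointwise) (sum-+ (λ w → if a v w then f w else 0) (λ w → if a v w then g w else 0))
    where
    pointwise : ∀ w → (if a v w then f w + g w else 0) ≡ (if a v w then f w else 0) + (if a v w then g w else 0)
    pointwise w with a v w
    ... | true  = refl
    ... | false = refl

  nbrSum-const : ∀ v c → nbrSum v (λ _ → c) ≡ c * deg T v
  nbrSum-const v c = trans (sum-cong pointwise) (sum-* c (𝟙 ∘ a v))
    where
    pointwise : ∀ w → (if a v w then c else 0) ≡ c * 𝟙 (a v w)
    pointwise w with a v w
    ... | true  = ≡.sym (*-identityʳ c)
    ... | false = ≡.sym (*-zeroʳ c)

  nbrSum-* : ∀ v c (f : Fin n → ℕ) → c * nbrSum v f ≡ nbrSum v (λ w → c * f w)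
  nbrSum-* v c f = trans (≡.sym (sum-* c (λ w → if a v w then f w else 0))) (sum-cong pointwise)
    where
    pointwise : ∀ w → c * (if a v w then f w else 0) ≡ (if a v w then c * f w else 0)
    pointwise w with a v w
    ... | true  = refl
    ... | false = *-zeroʳ c

  nbrSum-by-pendency : ∀ v (P R : ℕ) → nbrSum v (λ w → if pendent w then P else R) ≡ P * pendentNbrs T v + R * innerNbrs v
  nbrSum-by-pendency v P R = trans (sum-cong pointwise)
    (trans (sum-+ (λ w → P * 𝟙 (a v w ∧ pendent w)) (λ w → R * 𝟙 (a v w ∧ not (pendent w))))
           (cong₂ _+_ (sum-* P (λ w → 𝟙 (a v w ∧ pendent w))) (sum-* R (λ w → 𝟙 (a v w ∧ not (pendent w))))))
    where
    pointwise : ∀ w → (if a v w then (if pendent w then P else R) else 0)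
                    ≡ P * 𝟙 (a v w ∧ pendent w) + R * 𝟙 (a v w ∧ not (pendent w))
    pointwise w with a v w | pendent w
    ... | true  | true  = ≡.sym (trans (cong₂ _+_ (*-identityʳ P) (*-zeroʳ R)) (+-identityʳ P))
    ... | true  | false = ≡.sym (cong₂ _+_ (*-zeroʳ P) (*-identityʳ R))
    ... | false | _     = ≡.sym (cong₂ _+_ (*-zeroʳ P) (*-zeroʳ R))

  nbrSum-swap : (f : Fin n → Fin n → ℕ) → sumFin (λ v → nbrSum v (λ w → f w v)) ≡ sumFin (λ v → nbrSum v (f v))
  nbrSum-swap f = trans (sum-swap (λ v w → if a v w then f w v else 0))
                        (sum-cong (λ w → sum-cong (λ v → cong (λ b → if b then f w v else 0) (sym T v w))))

  defect : Fin n → Fin n → ℕ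
  defect v w = if pendent v ∨ pendent w then 0 else Q (vtype v) (vtype w)

  defect-symmetric : ∀ x w → defect x w ≡ defect w x
  defect-symmetric x w rewrite ∨-comm (pendent x) (pendent w) | Q-sym (vtype x) (vtype w) = refl

  row : Fin n → ℕ
  row v = nbrSum v (defect v)

  totalDefect : ℕ
  totalDefect = sumFin row

  -- Potential moved along the ordered edge (v, w) in the discharging argument.
  flow : Fin n → Fin n → ℕ
  flow v w = if pendent w then 0 else (if pendent v then 48 + 6 * deg T w else γ (vtype w))

  charge : Fin n → Fin n → ℕ
  charge v w = 6 * deg T v * (deg T w ∸ 1) + defect v w + flow w v

  -- Balance at a pendent vertex v: its neighbour w is non-pendent and the charge of (v, w) is
  -- the outgoing flow minus 54.
  pendent-balance : ∀ v → Pendent T v → nbrSum v (charge v) + 168 ≡ 114 * deg T v + nbrSum v (flow v)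
  pendent-balance v v-pendent = begin
    nbrSum v (charge v) + 168                   ≡⟨ +-assoc (nbrSum v (charge v)) 54 114 ⟨
    nbrSum v (charge v) + 54 + 114              ≡⟨ cong (λ x → nbrSum v (charge v) + x + 114) (trans (cong (54 *_) v-pendent) (*-identityʳ 54)) ⟨
    nbrSum v (charge v) + 54 * deg T v + 114    ≡⟨ cong (λ x → nbrSum v (charge v) + x + 114) (nbrSum-const v 54) ⟨
    nbrSum v (charge v) + nbrSum v (λ _ → 54) + 114
      ≡⟨ cong (_+ 114) (trans (≡.sym (nbrSum-+ v (charge v) (λ _ → 54))) (nbrSum-cong v edge)) ⟩
    nbrSum v (flow v) + 114                     ≡⟨ +-comm _ 114 ⟩
    114 + nbrSum v (flow v)                     ≡⟨ cong (λ d → 114 * d + nbrSum v (flow v)) v-pendent ⟨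
    114 * deg T v + nbrSum v (flow v)           ∎
    where
    open ≡.≡-Reasoning
    edge : ∀ {w} → Adj T v w → charge v w + 54 ≡ flow v w
    edge {w} v~w rewrite pendent-yes v-pendent | pendent-no (pendent-nonadjacent v~w v-pendent) | v-pendent
      with deg T w | deg≥1 w
    ... | suc m | _ = solve m
      where
      solve : ∀ m → 6 * 1 * m + 0 + 0 + 54 ≡ 48 + 6 * suc m
      solve = solve-∀

  -- Balance at a non-pendent vertex v: the charge of (v, w) is the outgoing flow plus 48 + 6 d_v
  -- for a pendent neighbour w, or β of the type of v for a non-pendent one (pair-identity); the
  -- vertex identity adds these extras up to 114 d_v − 168.
  inner-balance : ∀ v → ¬ Pendent T v → nbrSum v (charge v) + 168 ≡ 114 * deg T v + nbrSum v (flow v)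
  inner-balance v v-inner = begin
    nbrSum v (charge v) + 168
      ≡⟨ cong (_+ 168) (trans (nbrSum-cong v edge) (nbrSum-+ v (flow v) extra)) ⟩
    nbrSum v (flow v) + nbrSum v extra + 168
      ≡⟨ cong (λ x → nbrSum v (flow v) + x + 168) (nbrSum-by-pendency v (48 + 6 * deg T v) (β (vtype v))) ⟩
    nbrSum v (flow v) + ((48 + 6 * deg T v) * pendentNbrs T v + β (vtype v) * innerNbrs v) + 168
      ≡⟨ +-assoc (nbrSum v (flow v)) _ 168 ⟩
    nbrSum v (flow v) + ((48 + 6 * deg T v) * pendentNbrs T v + β (vtype v) * innerNbrs v + 168)
      ≡⟨ cong (nbrSum v (flow v) +_) vertex ⟩
    nbrSum v (flow v) + 114 * deg T v
      ≡⟨ +-comm (nbrSum v (flow v)) _ ⟩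
    114 * deg T v + nbrSum v (flow v) ∎
    where
    open ≡.≡-Reasoning
    extra : Fin n → ℕ
    extra w = if pendent w then 48 + 6 * deg T v else β (vtype v)
    vertex : (48 + 6 * deg T v) * pendentNbrs T v + β (vtype v) * innerNbrs v + 168 ≡ 114 * deg T v
    vertex rewrite innerNbrs≡ v = vertex-identity (realizable-at v v-inner)
    edge : ∀ {w} → Adj T v w → charge v w ≡ flow v w + extra w
    edge {w} v~w with pendent w in w-pendent
    ... | true rewrite pendent-no v-inner | pendent-true w-pendent =
          cong (λ x → x + 0 + (48 + 6 * deg T v)) (*-zeroʳ (6 * deg T v))
    ... | false rewrite pendent-no v-inner =
          subst₂ (λ d d′ → 6 * d * (d′ ∸ 1) + Q (vtype v) (vtype w) + γ (vtype v) ≡ γ (vtype w) + β (vtype v))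
                 (deg-vtype v v-inner) (deg-vtype w (pendent-false w-pendent))
                 (pair-identity (vtype v) (vtype w) (compatible-at v~w v-inner (pendent-false w-pendent)))

  vertex-balance : ∀ v → nbrSum v (charge v) + 168 ≡ 114 * deg T v + nbrSum v (flow v)
  vertex-balance v = [ pendent-balance v , inner-balance v ]′ (pendent-or-inner v)

  six-ZC : 6 * ZC1* T ≡ sumFin (λ v → nbrSum v (λ w → 6 * deg T v * (deg T w ∸ 1)))
  six-ZC = begin
    6 * ZC1* T                                                 ≡⟨ sum-* 6 (λ v → deg T v * tau T v) ⟨
    sumFin (λ v → 6 * (deg T v * tau T v))                     ≡⟨ sum-cong per-vertex ⟩
    sumFin (λ v → nbrSum v (λ w → 6 * deg T v * (deg T w ∸ 1))) ∎
    where
    open ≡.≡-Reasoning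
    per-vertex : ∀ v → 6 * (deg T v * tau T v) ≡ nbrSum v (λ w → 6 * deg T v * (deg T w ∸ 1))
    per-vertex v = trans (≡.sym (*-assoc 6 (deg T v) (tau T v)))
      (trans (cong (6 * deg T v *_) (tau-formula acyclic v)) (nbrSum-* v (6 * deg T v) (λ w → deg T w ∸ 1)))

  degrees : sumFin (deg T) ≡ 2 * (n ∸ 1)
  degrees = degree-sum tree some-vertex

  -- Adding the vertex balances: the flows cancel, leaving 6 · ZC₁* + (total defect) = 60n − 228.
  main-identity : 6 * ZC1* T + totalDefect + 228 ≡ 60 * n
  main-identity = balance-arithmetic (6 * ZC1* T + totalDefect) (≤-trans (s≤s z≤n) 7≤n) (+-cancelʳ-≡ F _ _ (begin
    6 * ZC1* T + totalDefect + 168 * n + F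
      ≡⟨ rearrange (6 * ZC1* T) totalDefect (168 * n) F ⟩
    6 * ZC1* T + totalDefect + F + 168 * n
      ≡⟨ cong₂ (λ x y → x + totalDefect + y + 168 * n) six-ZC (≡.sym (nbrSum-swap flow)) ⟩
    sumFin (λ v → nbrSum v (λ w → 6 * deg T v * (deg T w ∸ 1))) + totalDefect
      + sumFin (λ v → nbrSum v (λ w → flow w v)) + 168 * n
      ≡⟨ cong₂ _+_ charges (trans (*-comm 168 n) (≡.sym (sum-const n 168))) ⟩
    sumFin (λ v → nbrSum v (charge v)) + sumFin {n} (λ _ → 168)
      ≡⟨ sum-+ (λ v → nbrSum v (charge v)) (λ _ → 168) ⟨
    sumFin (λ v → nbrSum v (charge v) + 168)
      ≡⟨ sum-cong vertex-balance ⟩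
    sumFin (λ v → 114 * deg T v + nbrSum v (flow v))
      ≡⟨ trans (sum-+ (λ v → 114 * deg T v) (λ v → nbrSum v (flow v))) (cong (_+ F) (sum-* 114 (deg T))) ⟩
    114 * sumFin (deg T) + F
      ≡⟨ cong (λ s → 114 * s + F) degrees ⟩
    114 * (2 * (n ∸ 1)) + F ∎))
    where
    open ≡.≡-Reasoning
    F : ℕ
    F = sumFin (λ v → nbrSum v (flow v))
    rearrange : ∀ a b c d → a + b + c + d ≡ a + b + d + c
    rearrange a b c d = trans (+-assoc (a + b) c d) (trans (cong (a + b +_) (+-comm c d)) (≡.sym (+-assoc (a + b) d c)))
    charges : sumFin (λ v → nbrSum v (λ w → 6 * deg T v * (deg T w ∸ 1))) + totalDefect
                + sumFin (λ v → nbrSum v (λ w → flow w v))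
            ≡ sumFin (λ v → nbrSum v (charge v))
    charges = ≡.sym (trans (sum-cong split)
      (trans (sum-+ (λ v → nbrSum v (λ w → 6 * deg T v * (deg T w ∸ 1)) + row v) (λ v → nbrSum v (λ w → flow w v)))
             (cong (_+ sumFin (λ v → nbrSum v (λ w → flow w v)))
                   (sum-+ (λ v → nbrSum v (λ w → 6 * deg T v * (deg T w ∸ 1))) row))))
      where
      split : ∀ v → nbrSum v (charge v) ≡ nbrSum v (λ w → 6 * deg T v * (deg T w ∸ 1)) + row v + nbrSum v (λ w → flow w v)
      split v = trans (nbrSum-+ v (λ w → 6 * deg T v * (deg T w ∸ 1) + defect v w) (λ w → flow w v))
                      (cong (_+ nbrSum v (λ w → flow w v)) (nbrSum-+ v (λ w → 6 * deg T v * (deg T w ∸ 1)) (defect v)))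

  defect-inner : ∀ {v w} → ¬ Pendent T v → ¬ Pendent T w → defect v w ≡ Q (vtype v) (vtype w)
  defect-inner v-inner w-inner rewrite pendent-no v-inner | pendent-no w-inner = refl

  row-≥-edge : ∀ {v w} → Adj T v w → ¬ Pendent T v → ¬ Pendent T w → Q (vtype v) (vtype w) ≤ row v
  row-≥-edge {v} {w} v~w v-inner w-inner =
    subst (_≤ row v) (trans (cong (λ b → if b then defect v w else 0) v~w) (defect-inner v-inner w-inner))
          (sum-≥-one (λ u → if a v u then defect v u else 0) w)

  row-≥-two-edges : ∀ {v x y} → x ≢ y → Adj T v x → Adj T v y → ¬ Pendent T v → ¬ Pendent T x → ¬ Pendent T y →
    Q (vtype v) (vtype x) + Q (vtype v) (vtype y) ≤ row v
  row-≥-two-edges {v} {x} {y} x≢y v~x v~y v-inner x-inner y-inner =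
    subst (_≤ row v) (cong₂ _+_ (at v~x x-inner) (at v~y y-inner)) (sum-≥-two (λ u → if a v u then defect v u else 0) x≢y)
    where
    at : ∀ {w} → Adj T v w → ¬ Pendent T w → (if a v w then defect v w else 0) ≡ Q (vtype v) (vtype w)
    at {w} v~w w-inner = trans (cong (λ b → if b then defect v w else 0) v~w) (defect-inner v-inner w-inner)

  -- A degree-2 vertex cannot lie between two vertices of type t21: that would be a tree on six vertices.
  no-t21-pair : ∀ {v x y} → deg T v ≡ 2 → Adj T v x → Adj T v y → x ≢ y → ¬ Pendent T x → ¬ Pendent T y →
    vtype x ≡ t21 → vtype y ≡ t21 → ⊥
  no-t21-pair {v} {x} {y} v-deg2 v~x v~y x≢y x-inner y-inner x-t21 y-t21 =
    too-small (≤-reflexive (cong₂ _+_ (cong₂ _+_ v-deg2 (proj₁ x-data)) (proj₁ y-data)))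
      (triple-star-bound v-deg2 v~x v~y x≢y (sole x-inner x-data (Adj-sym v~x)) (sole y-inner y-data (Adj-sym v~y)))
    where
    x-data : deg T x ≡ 2 × pendentNbrs T x ≡ 1
    x-data = t21-data (realizable-at x x-inner) x-t21
    y-data : deg T y ≡ 2 × pendentNbrs T y ≡ 1
    y-data = t21-data (realizable-at y y-inner) y-t21
    v-inner : ¬ Pendent T v
    v-inner v-pendent = contradiction (trans (≡.sym v-deg2) v-pendent) λ ()
    sole : ∀ {u} → ¬ Pendent T u → deg T u ≡ 2 × pendentNbrs T u ≡ 1 → Adj T u v → ∀ {z} → Adj T u z → z ≢ v → Pendent T z
    sole {u} u-inner (d≡2 , k≡1) u~v = sole-inner-nbr (trans (innerNbrs≡ u) (cong₂ _∸_ d≡2 k≡1)) u~v v-inner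

  heavy-rows : ∀ {v x y} → ¬ Pendent T v → Heavy (vtype v) → Adj T v x → ¬ Pendent T x → Adj T v y → ¬ Pendent T y →
    x ≢ y → 15 ≤ totalDefect
  heavy-rows {v} {x} {y} v-inner heavy v~x x-inner v~y y-inner x≢y =
    ≤-trans (+-mono-≤ at-v at-x) (sum-≥-two row (Adj-irrefl v~x))
    where
    not-t21-pair : tdeg (vtype v) ≡ 2 → ¬ (vtype x ≡ t21 × vtype y ≡ t21)
    not-t21-pair deg2 (x-t21 , y-t21) =
      no-t21-pair (trans (≡.sym (deg-vtype v v-inner)) deg2) v~x v~y x≢y x-inner y-inner x-t21 y-t21
    at-v : 12 ≤ row v
    at-v = ≤-trans (Q-heavy-pair heavy (vtype x) (vtype y) not-t21-pair) (row-≥-two-edges x≢y v~x v~y v-inner x-inner y-inner)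
    at-x : 3 ≤ row x
    at-x = ≤-trans (subst (3 ≤_) (Q-sym (vtype v) (vtype x)) (Q-heavy heavy (vtype x)))
                   (row-≥-edge (Adj-sym v~x) x-inner v-inner)

  -- A heavy vertex has two non-pendent neighbours, so it forces a total defect of at least 15.
  heavy-defect : ∀ v → ¬ Pendent T v → Heavy (vtype v) → 15 ≤ totalDefect
  heavy-defect v v-inner heavy = first (inner-nbr v v-inner)
    where
    first : (∃ λ x → Adj T v x × ¬ Pendent T x) → 15 ≤ totalDefect
    first (x , v~x , x-inner) = second (inner-nbr-avoiding v two-inner x)
      where
      two-inner : 2 ≤ innerNbrs v
      two-inner = subst (2 ≤_) (≡.sym (innerNbrs≡ v)) (heavy-inner (realizable-at v v-inner) heavy)
      second : (∃ λ y → Adj T v y × ¬ Pendent T y × y ≢ x) → 15 ≤ totalDefect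
      second (y , v~y , y-inner , y≢x) = heavy-rows v-inner heavy v~x x-inner v~y y-inner (y≢x ∘ ≡.sym)

  module WithoutHeavy (no-heavy : ∀ v → ¬ Pendent T v → ¬ Heavy (vtype v)) where

    light-nbr : ∀ {u w} → ¬ Pendent T u → Light (vtype u) → Adj T u w → ¬ Pendent T w → vtype w ≡ t4
    light-nbr {u} {w} u-inner u-light u~w w-inner = by-degree (deg T w ≟ 4)
      where
      by-degree : Dec (deg T w ≡ 4) → vtype w ≡ t4
      by-degree (yes w-deg4) = cong (λ d → type d (pendentNbrs T w)) w-deg4
      by-degree (no w-deg≢4) = [ (λ w-heavy → contradiction w-heavy (no-heavy w w-inner))
                               , (λ w-light → ⊥-elim (light-pair-impossible u~w u-inner w-inner u-light w-light))
                               ]′ (heavy-or-light (realizable-at w w-inner) w-deg≢4)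

    LightRows : Fin n → Set
    LightRows u = ∃ λ w → Adj T u w × vtype w ≡ t4 × 6 ≤ row u × 6 ≤ row w

    light-rows : ∀ u → ¬ Pendent T u → Light (vtype u) → LightRows u
    light-rows u u-inner u-light = rows (inner-nbr u u-inner)
      where
      rows : (∃ λ w → Adj T u w × ¬ Pendent T w) → LightRows u
      rows (w , u~w , w-inner) = w , u~w , w-t4
        , subst (_≤ row u) (trans (cong (Q (vtype u)) w-t4) (Q-light u-light)) (row-≥-edge u~w u-inner w-inner)
        , subst (_≤ row w) (trans (cong (λ t → Q t (vtype u)) w-t4) (trans (Q-sym t4 (vtype u)) (Q-light u-light)))
                (row-≥-edge (Adj-sym u~w) w-inner u-inner)
        where
        w-t4 : vtype w ≡ t4
        w-t4 = light-nbr u-inner u-light u~w w-inner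

    light-defect : ∀ u → ¬ Pendent T u → Light (vtype u) → 12 ≤ totalDefect
    light-defect u u-inner u-light = two-rows (light-rows u u-inner u-light)
      where
      two-rows : LightRows u → 12 ≤ totalDefect
      two-rows (w , u~w , _ , at-u , at-w) = ≤-trans (+-mono-≤ at-u at-w) (sum-≥-two row (Adj-irrefl u~w))

    two-light-defect : ∀ u u′ → u ≢ u′ → ¬ Pendent T u → Light (vtype u) → ¬ Pendent T u′ → Light (vtype u′) →
      18 ≤ totalDefect
    two-light-defect u u′ u≢u′ u-inner u-light u′-inner u′-light = three-rows (light-rows u u-inner u-light) (light-rows u′ u′-inner u′-light)
      where
      three-rows : LightRows u → LightRows u′ → 18 ≤ totalDefect
      three-rows (w , u~w , w-t4 , at-u , at-w) (_ , _ , _ , at-u′ , _) =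
        ≤-trans (+-mono-≤ (+-mono-≤ at-u at-u′) at-w) (sum-≥-three row u≢u′ (Adj-irrefl u~w) u′≢w)
        where
        u′≢w : u′ ≢ w
        u′≢w refl = case (subst Light w-t4 u′-light)
          where
          case : ¬ Light t4
          case ()

  heavy-exists? : Dec (∃ λ v → ¬ Pendent T v × Heavy (vtype v))
  heavy-exists? = any? (λ v → ¬? (deg T v ≟ 1) ×-dec heavy? (vtype v))

  light-if-no-heavy : ¬ (∃ λ u → ¬ Pendent T u × Heavy (vtype u)) → ∀ v → ¬ Pendent T v → deg T v ≢ 4 → Light (vtype v)
  light-if-no-heavy no-heavy v v-inner v-deg≢4 =
    [ (λ v-heavy → contradiction (v , v-inner , v-heavy) no-heavy) , (λ v-light → v-light) ]′
      (heavy-or-light (realizable-at v v-inner) v-deg≢4)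

  defect-≥-12 : ∀ v → ¬ Pendent T v → deg T v ≢ 4 → 12 ≤ totalDefect
  defect-≥-12 v v-inner v-deg≢4 = by-heaviness heavy-exists?
    where
    by-heaviness : Dec (∃ λ u → ¬ Pendent T u × Heavy (vtype u)) → 12 ≤ totalDefect
    by-heaviness (yes (u , u-inner , u-heavy)) = ≤-trans (m≤m+n 12 3) (heavy-defect u u-inner u-heavy)
    by-heaviness (no no-heavy) = WithoutHeavy.light-defect (λ u u-inner u-heavy → no-heavy (u , u-inner , u-heavy))
                                   v v-inner (light-if-no-heavy no-heavy v v-inner v-deg≢4)

  defect-≤-12 : totalDefect ≤ 12 → ∀ v → ¬ Pendent T v → deg T v ≢ 4 →
    Light (vtype v) × (∀ u → ¬ Pendent T u → deg T u ≢ 4 → u ≡ v)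
  defect-≤-12 ≤12 v v-inner v-deg≢4 = by-heaviness heavy-exists?
    where
    exceeds : ∀ {m} → 13 ≤ m → m ≤ totalDefect → ⊥
    exceeds 13≤m m≤ = contradiction (≤-trans 13≤m (≤-trans m≤ ≤12)) λ { (s≤s (s≤s (s≤s (s≤s (s≤s (s≤s (s≤s (s≤s (s≤s (s≤s (s≤s (s≤s ())))))))))))) }
    by-heaviness : Dec (∃ λ u → ¬ Pendent T u × Heavy (vtype u)) →
      Light (vtype v) × (∀ u → ¬ Pendent T u → deg T u ≢ 4 → u ≡ v)
    by-heaviness (yes (u , u-inner , u-heavy)) = ⊥-elim (exceeds (m≤m+n 13 2) (heavy-defect u u-inner u-heavy))
    by-heaviness (no no-heavy) = light v v-inner v-deg≢4 , unique
      where
      light : ∀ u → ¬ Pendent T u → deg T u ≢ 4 → Light (vtype u)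
      light = light-if-no-heavy no-heavy
      unique : ∀ u → ¬ Pendent T u → deg T u ≢ 4 → u ≡ v
      unique u u-inner u-deg≢4 = decidable-stable (u ≟ᶠ v) λ u≢v → exceeds (m≤m+n 13 5)
        (WithoutHeavy.two-light-defect (λ w w-inner w-heavy → no-heavy (w , w-inner , w-heavy))
           u v u≢v u-inner (light u u-inner u-deg≢4) v-inner (light v v-inner v-deg≢4))

  defect-vanishes : ∀ {x w} → (¬ Pendent T x → vtype x ≡ t4) → (¬ Pendent T w → vtype w ≡ t4) → defect x w ≡ 0
  defect-vanishes {x} {w} x-t4 w-t4 = by-pendency (pendent-or-inner x) (pendent-or-inner w)
    where
    by-pendency : Pendent T x ⊎ ¬ Pendent T x → Pendent T w ⊎ ¬ Pendent T w → defect x w ≡ 0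
    by-pendency (inj₁ x-pendent) _ rewrite pendent-yes x-pendent = refl
    by-pendency (inj₂ _) (inj₁ w-pendent) rewrite pendent-yes w-pendent | ∨-zeroʳ (pendent x) = refl
    by-pendency (inj₂ x-inner) (inj₂ w-inner) = trans (defect-inner x-inner w-inner) (cong₂ Q (x-t4 x-inner) (w-t4 w-inner))

  deg4-type : ∀ {u} → deg T u ≡ 1 ⊎ deg T u ≡ 4 → ¬ Pendent T u → vtype u ≡ t4
  deg4-type (inj₁ u-pendent) u-inner = contradiction u-pendent u-inner
  deg4-type {u} (inj₂ u-deg4) _ = cong (λ d → type d (pendentNbrs T u)) u-deg4

  defect-all-1-or-4 : (∀ u → deg T u ≡ 1 ⊎ deg T u ≡ 4) → totalDefect ≡ 0
  defect-all-1-or-4 one-or-four = sum-zero (λ x → sum-zero (pointwise x))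
    where
    pointwise : ∀ x w → (if a x w then defect x w else 0) ≡ 0
    pointwise x w with a x w
    ... | true  = defect-vanishes (deg4-type (one-or-four x)) (deg4-type (one-or-four w))
    ... | false = refl

  -- With a single light vertex v and all other vertices of degree 1 or 4, the edges from v to
  -- its non-pendent neighbour carry Q = 6 in both directions and all other edges carry nothing.
  module SingleLight (v : Fin n) (v-inner : ¬ Pendent T v) (v-light : Light (vtype v))
                     (others : ∀ u → u ≢ v → deg T u ≡ 1 ⊎ deg T u ≡ 4) where

    weight : Fin n → ℕ
    weight z = if pendent z then 0 else 6

    -- the part of the defect of the edge (y, z) attributed to the light vertex
    share : Fin n → Fin n → ℕ
    share y z = if y == v then weight z else 0

    defect-at-v : ∀ {w} → w ≢ v → defect v w ≡ weight w
    defect-at-v {w} w≢v = by-pendency (pendent-or-inner w)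
      where
      by-pendency : Pendent T w ⊎ ¬ Pendent T w → defect v w ≡ weight w
      by-pendency (inj₁ w-pendent) rewrite pendent-yes w-pendent | ∨-zeroʳ (pendent v) = refl
      by-pendency (inj₂ w-inner) = trans (defect-inner v-inner w-inner)
        (trans (trans (cong (Q (vtype v)) (deg4-type (others w w≢v) w-inner)) (Q-light v-light))
               (cong (λ b → if b then 0 else 6) (≡.sym (pendent-no w-inner))))

    defect-by-share : ∀ {x w} → Adj T x w → defect x w ≡ share x w + share w x
    defect-by-share {x} {w} x~w = by-position (x ≟ᶠ v) (w ≟ᶠ v)
      where
      by-position : Dec (x ≡ v) → Dec (w ≡ v) → defect x w ≡ share x w + share w x
      by-position (yes refl) (yes refl) = contradiction refl (Adj-irrefl x~w)
      by-position (yes refl) (no w≢v) rewrite ==-refl x | ==-≢ w≢v = trans (defect-at-v w≢v) (≡.sym (+-identityʳ _))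
      by-position (no x≢v) (yes refl) rewrite ==-refl w | ==-≢ x≢v = trans (defect-symmetric x w) (defect-at-v x≢v)
      by-position (no x≢v) (no w≢v) rewrite ==-≢ x≢v | ==-≢ w≢v =
        defect-vanishes (deg4-type (others x x≢v)) (deg4-type (others w w≢v))

    share-sum : sumFin (λ x → nbrSum x (share x)) ≡ 6
    share-sum = begin
      sumFin (λ x → nbrSum x (share x))        ≡⟨ sum-cong only-v ⟩
      sumFin (only v (λ x → nbrSum x weight))  ≡⟨ sum-point v (λ x → nbrSum x weight) ⟩
      nbrSum v weight                          ≡⟨ nbrSum-by-pendency v 0 6 ⟩
      6 * innerNbrs v                          ≡⟨ cong (6 *_) (proj₁ (light-shape v v-inner v-light)) ⟩
      6                                        ∎
      where
      open ≡.≡-Reasoning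
      only-v : ∀ x → nbrSum x (share x) ≡ only v (λ y → nbrSum y weight) x
      only-v x with x ≟ᶠ v
      ... | yes _ = refl
      ... | no _  = sum-zero {n} (λ w → zero-if (a x w))
        where
        zero-if : ∀ b → (if b then 0 else 0) ≡ 0
        zero-if true  = refl
        zero-if false = refl

    defect-single-light : totalDefect ≡ 12
    defect-single-light = begin
      totalDefect                                                  ≡⟨ sum-cong (λ x → nbrSum-cong x defect-by-share) ⟩
      sumFin (λ x → nbrSum x (λ w → share x w + share w x))        ≡⟨ sum-cong (λ x → nbrSum-+ x (share x) (λ w → share w x)) ⟩
      sumFin (λ x → nbrSum x (share x) + nbrSum x (λ w → share w x))
        ≡⟨ sum-+ (λ x → nbrSum x (share x)) (λ x → nbrSum x (λ w → share w x)) ⟩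
      sumFin (λ x → nbrSum x (share x)) + sumFin (λ x → nbrSum x (λ w → share w x))
        ≡⟨ cong₂ _+_ share-sum (trans (nbrSum-swap share) share-sum) ⟩
      12                                                           ∎
      where open ≡.≡-Reasoning

  -- If every vertex other than v has degree 1 or 4, then n ≡ d_v + 1 (mod 3): besides d_v the
  -- degree sum 2(n − 1) consists of ones and fours, one for each of the other n − 1 vertices.
  degree-mod-3 : ∀ v → (∀ u → u ≢ v → deg T u ≡ 1 ⊎ deg T u ≡ 4) → n % 3 ≡ (deg T v + 1) % 3
  degree-mod-3 v others = trans (cong (_% 3) n≡) ([m+kn]%n≡m%n (deg T v + 1) fours 3)
    where
    four : Fin n → Bool
    four u = not (u == v) ∧ ⌊ deg T u ≟ 4 ⌋
    fours : ℕ
    fours = countFin four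
    pointwise : ∀ u → deg T u + only v (λ _ → 1) u ≡ 1 + 3 * 𝟙 (four u) + only v (deg T) u
    pointwise u with u ≟ᶠ v
    ... | yes refl = +-comm (deg T u) 1
    ... | no u≢v with others u u≢v
    ...   | inj₁ u-deg1 rewrite u-deg1 = refl
    ...   | inj₂ u-deg4 rewrite u-deg4 = refl
    total : sumFin (deg T) + 1 ≡ n + 3 * fours + deg T v
    total = begin
      sumFin (deg T) + 1                                   ≡⟨ cong (sumFin (deg T) +_) (sum-point v (λ _ → 1)) ⟨
      sumFin (deg T) + sumFin (only v (λ _ → 1))           ≡⟨ sum-+ (deg T) (only v (λ _ → 1)) ⟨
      sumFin (λ u → deg T u + only v (λ _ → 1) u)          ≡⟨ sum-cong pointwise ⟩
      sumFin (λ u → 1 + 3 * 𝟙 (four u) + only v (deg T) u)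
        ≡⟨ trans (sum-+ (λ u → 1 + 3 * 𝟙 (four u)) (only v (deg T)))
                 (cong₂ _+_ (trans (sum-+ (λ _ → 1) (λ u → 3 * 𝟙 (four u)))
                                   (cong₂ _+_ (trans (sum-const n 1) (*-identityʳ n)) (sum-* 3 (𝟙 ∘ four))))
                            (sum-point v (deg T))) ⟩
      n + 3 * fours + deg T v                              ∎
      where open ≡.≡-Reasoning
    n≡ : n ≡ deg T v + 1 + fours * 3
    n≡ = degree-count-arithmetic fours (deg T v) (≤-trans (s≤s z≤n) 7≤n) (trans (cong (_+ 1) (≡.sym degrees)) total)

  exceptional-or-uniform : (∃ λ v → ¬ Pendent T v × deg T v ≢ 4) ⊎ (∀ u → deg T u ≡ 1 ⊎ deg T u ≡ 4)
  exceptional-or-uniform with any? (λ v → ¬? (deg T v ≟ 1) ×-dec ¬? (deg T v ≟ 4))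
  ... | yes exceptional = inj₁ exceptional
  ... | no none = inj₂ uniform
    where
    uniform : ∀ u → deg T u ≡ 1 ⊎ deg T u ≡ 4
    uniform u with deg T u ≟ 1 | deg T u ≟ 4
    ... | yes u-deg1 | _         = inj₁ u-deg1
    ... | no _       | yes u-deg4 = inj₂ u-deg4
    ... | no u-inner | no u-deg≢4 = contradiction (u , u-inner , u-deg≢4) none

  uniform-mod-3 : (∀ u → deg T u ≡ 1 ⊎ deg T u ≡ 4) → n % 3 ≡ 2
  uniform-mod-3 uniform with degree-mod-3 some-vertex (λ u _ → uniform u) | uniform some-vertex
  ... | n-mod | inj₁ deg1 rewrite deg1 = n-mod
  ... | n-mod | inj₂ deg4 rewrite deg4 = n-mod

  Extremal : Set
  Extremal = (n % 3 ≡ 0 × ∃ λ v → deg T v ≡ 2 × (∀ u → deg T u ≡ 2 → u ≡ v)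
                × (∃ λ w → Adj T v w × deg T w ≡ 1)
                × (∀ u → u ≢ v → deg T u ≡ 1 ⊎ deg T u ≡ 4))
           ⊎ (n % 3 ≡ 1 × ∃ λ v → deg T v ≡ 3 × (∀ u → deg T u ≡ 3 → u ≡ v)
                × pendentNbrs T v ≡ 2
                × (∀ u → u ≢ v → deg T u ≡ 1 ⊎ deg T u ≡ 4))

  module _ (v : Fin n) (unique : ∀ u → ¬ Pendent T u → deg T u ≢ 4 → u ≡ v) where

    others-1-or-4 : ∀ u → u ≢ v → deg T u ≡ 1 ⊎ deg T u ≡ 4
    others-1-or-4 u u≢v with deg T u ≟ 1 | deg T u ≟ 4
    ... | yes u-deg1 | _          = inj₁ u-deg1
    ... | no _       | yes u-deg4 = inj₂ u-deg4
    ... | no u-inner | no u-deg≢4 = contradiction (unique u u-inner u-deg≢4) u≢v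

    unique-of-degree : ∀ {d} → d ≢ 1 → d ≢ 4 → ∀ u → deg T u ≡ d → u ≡ v
    unique-of-degree d≢1 d≢4 u u-deg = unique u (d≢1 ∘ trans (≡.sym u-deg)) (d≢4 ∘ trans (≡.sym u-deg))

    mod-3 : ∀ {d} → deg T v ≡ d → n % 3 ≡ (d + 1) % 3
    mod-3 v-deg = trans (degree-mod-3 v others-1-or-4) (cong (λ d → (d + 1) % 3) v-deg)

    extremal-light : ¬ Pendent T v → Light (vtype v) → Extremal
    extremal-light v-inner v-light with light-types v-light
    ... | inj₁ v-t21 = inj₁ (mod-3 v-deg2 , v , v-deg2 , unique-of-degree (λ ()) (λ ()) , pendent-nbr , others-1-or-4)
      where
      v-data : deg T v ≡ 2 × pendentNbrs T v ≡ 1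
      v-data = t21-data (realizable-at v v-inner) v-t21
      v-deg2 : deg T v ≡ 2
      v-deg2 = proj₁ v-data
      pendent-nbr : ∃ λ w → Adj T v w × deg T w ≡ 1
      pendent-nbr with count-witness (λ u → a v u ∧ pendent u) (≤-reflexive (≡.sym (proj₂ v-data)))
      ... | w , w-nbr = w , proj₁ (∧-true w-nbr) , pendent-true (proj₂ (∧-true w-nbr))
    ... | inj₂ v-t32 = inj₂ (mod-3 v-deg3 , v , v-deg3 , unique-of-degree (λ ()) (λ ()) , proj₂ v-data , others-1-or-4)
      where
      v-data : deg T v ≡ 3 × pendentNbrs T v ≡ 2
      v-data = t32-data (realizable-at v v-inner) v-t32
      v-deg3 : deg T v ≡ 3
      v-deg3 = proj₁ v-data

  extremal-from-defect : totalDefect ≡ 12 → Extremal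
  extremal-from-defect defect≡12 = [ exceptional , uniform ]′ exceptional-or-uniform
    where
    exceptional : (∃ λ v → ¬ Pendent T v × deg T v ≢ 4) → Extremal
    exceptional (v , v-inner , v-deg≢4) =
      extremal-light v (proj₂ light-unique) v-inner (proj₁ light-unique)
      where
      light-unique : Light (vtype v) × (∀ u → ¬ Pendent T u → deg T u ≢ 4 → u ≡ v)
      light-unique = defect-≤-12 (≤-reflexive defect≡12) v v-inner v-deg≢4
    uniform : (∀ u → deg T u ≡ 1 ⊎ deg T u ≡ 4) → Extremal
    uniform one-or-four = contradiction (trans (≡.sym defect≡12) (defect-all-1-or-4 one-or-four)) λ ()

  defect-from-extremal : Extremal → totalDefect ≡ 12
  defect-from-extremal (inj₁ (_ , v , v-deg2 , _ , (w , v~w , w-pendent) , others)) =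
    SingleLight.defect-single-light v v-inner (subst Light (≡.sym v-t21) l21) others
    where
    v-inner : ¬ Pendent T v
    v-inner v-pendent = contradiction (trans (≡.sym v-deg2) v-pendent) λ ()
    v-t21 : vtype v ≡ t21
    v-t21 = trans (cong (λ d → type d (pendentNbrs T v)) v-deg2)
      (deg2-pendent-type (subst (λ d → Realizable d (pendentNbrs T v)) v-deg2 (realizable-at v v-inner))
                         (count-≥1 (λ u → a v u ∧ pendent u) (cong₂ _∧_ v~w (pendent-yes w-pendent))))
  defect-from-extremal (inj₂ (_ , v , v-deg3 , _ , v-k2 , others)) =
    SingleLight.defect-single-light v v-inner (subst Light (≡.sym (cong₂ type v-deg3 v-k2)) l32) others
    where
    v-inner : ¬ Pendent T v
    v-inner v-pendent = contradiction (trans (≡.sym v-deg3) v-pendent) λ ()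

  defect-0-iff : totalDefect ≡ 0 ⇔ (n % 3 ≡ 2 × (∀ u → deg T u ≡ 1 ⊎ deg T u ≡ 4))
  defect-0-iff = mk⇔ to (defect-all-1-or-4 ∘ proj₂)
    where
    to : totalDefect ≡ 0 → n % 3 ≡ 2 × (∀ u → deg T u ≡ 1 ⊎ deg T u ≡ 4)
    to defect≡0 = [ (λ { (v , v-inner , v-deg≢4) → contradiction (subst (12 ≤_) defect≡0 (defect-≥-12 v v-inner v-deg≢4)) λ () })
                   , (λ uniform → uniform-mod-3 uniform , uniform) ]′ exceptional-or-uniform

  defect-12-iff : totalDefect ≡ 12 ⇔ Extremal
  defect-12-iff = mk⇔ extremal-from-defect defect-from-extremal

  exceptional-vertex : n % 3 ≡ 0 ⊎ n % 3 ≡ 1 → ∃ λ v → ¬ Pendent T v × deg T v ≢ 4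
  exceptional-vertex n-mod with exceptional-or-uniform
  ... | inj₁ exceptional = exceptional
  ... | inj₂ uniform with n-mod | uniform-mod-3 uniform
  ...   | inj₁ ≡0 | ≡2 = contradiction (trans (≡.sym ≡0) ≡2) λ ()
  ...   | inj₂ ≡1 | ≡2 = contradiction (trans (≡.sym ≡1) ≡2) λ ()

-- Reading off ZC₁* = Z from 6Z + S = 6B + 12, where S ≥ 0 is the total defect and B the bound.
module DefectArithmetic (Z S B : ℕ) (balance : 6 * Z + S ≡ 6 * B + 12) where

  bound-12 : 12 ≤ S → Z ≤ B
  bound-12 12≤S = *-cancelˡ-≤ 6 (+-cancelʳ-≤ 12 (6 * Z) (6 * B)
    (≤-trans (+-monoʳ-≤ (6 * Z) 12≤S) (≤-reflexive balance)))

  exact-12 : Z ≡ B ⇔ S ≡ 12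
  exact-12 = mk⇔ (λ { refl → +-cancelˡ-≡ (6 * Z) S 12 balance })
                 (λ { refl → *-cancelˡ-≡ Z B 6 (+-cancelʳ-≡ 12 (6 * Z) (6 * B) balance) })

  balance₂ : 6 * Z + S ≡ 6 * (B + 2)
  balance₂ = trans balance (≡.sym (*-distribˡ-+ 6 B 2))

  bound-0 : Z ≤ B + 2
  bound-0 = *-cancelˡ-≤ 6 (≤-trans (m≤m+n (6 * Z) S) (≤-reflexive balance₂))

  exact-0 : Z ≡ B + 2 ⇔ S ≡ 0
  exact-0 = mk⇔ (λ { refl → +-cancelˡ-≡ (6 * Z) S 0 (trans balance₂ (≡.sym (+-identityʳ _))) })
                (λ { refl → *-cancelˡ-≡ Z (B + 2) 6 (trans (≡.sym (+-identityʳ (6 * Z))) balance₂) })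

balance-bound : ∀ {n} Z S → 7 ≤ n → 6 * Z + S + 228 ≡ 60 * n → 6 * Z + S ≡ 6 * (10 * (n ∸ 4)) + 12
balance-bound {n} Z S 7≤n identity with m+[n∸m]≡n 7≤n
... | n≡ rewrite ≡.sym n≡ = +-cancelʳ-≡ 228 _ _ (trans identity (expand (n ∸ 7)))
  where
  expand : ∀ m → 60 * (7 + m) ≡ 6 * (10 * (3 + m)) + 12 + 228
  expand = solve-∀

second-bound : ∀ {n} → 7 ≤ n → 10 * (n ∸ 4) + 2 ≡ 2 * (5 * n ∸ 19)
second-bound {n} 7≤n with m+[n∸m]≡n 7≤n
... | n≡ rewrite ≡.sym n≡ = trans (regroup (n ∸ 7)) (cong (2 *_) (≡.sym (trans (cong (_∸ 19) (split (n ∸ 7))) (m+n∸m≡n 19 _))))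
  where
  regroup : ∀ m → 10 * (3 + m) + 2 ≡ 2 * (16 + 5 * m)
  regroup = solve-∀
  split : ∀ m → 5 * (7 + m) ≡ 19 + (16 + 5 * m)
  split = solve-∀

corollary3p9 : (n : ℕ) → n ≥ 7 → (T : Graph n) → IsTree T → IsChemical T →
  ((n % 3 ≡ 0 ⊎ n % 3 ≡ 1) →
    (ZC1* T ≤ 10 * (n ∸ 4))
    × (ZC1* T ≡ 10 * (n ∸ 4) ⇔
        ((n % 3 ≡ 0 × ∃ λ v → deg T v ≡ 2 × (∀ u → deg T u ≡ 2 → u ≡ v)
            × (∃ λ w → Adj T v w × deg T w ≡ 1)
            × (∀ u → u ≢ v → deg T u ≡ 1 ⊎ deg T u ≡ 4))
        ⊎ (n % 3 ≡ 1 × ∃ λ v → deg T v ≡ 3 × (∀ u → deg T u ≡ 3 → u ≡ v)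
            × pendentNbrs T v ≡ 2
            × (∀ u → u ≢ v → deg T u ≡ 1 ⊎ deg T u ≡ 4)))))
  × (¬ (n % 3 ≡ 0 ⊎ n % 3 ≡ 1) →
    (ZC1* T ≤ 2 * (5 * n ∸ 19))
    × (ZC1* T ≡ 2 * (5 * n ∸ 19) ⇔
        (n % 3 ≡ 2 × (∀ u → deg T u ≡ 1 ⊎ deg T u ≡ 4))))
corollary3p9 n 7≤n T tree chemical = not-two , two
  where
  open ChemicalTree T 7≤n tree chemical
  open DefectArithmetic (ZC1* T) totalDefect (10 * (n ∸ 4)) (balance-bound (ZC1* T) totalDefect 7≤n main-identity)
  not-two : n % 3 ≡ 0 ⊎ n % 3 ≡ 1 → ZC1* T ≤ 10 * (n ∸ 4) × (ZC1* T ≡ 10 * (n ∸ 4) ⇔ Extremal)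
  not-two n-mod with exceptional-vertex n-mod
  ... | v , v-inner , v-deg≢4 = bound-12 (defect-≥-12 v v-inner v-deg≢4) , defect-12-iff ⇔-∘ exact-12
  two : ¬ (n % 3 ≡ 0 ⊎ n % 3 ≡ 1) → ZC1* T ≤ 2 * (5 * n ∸ 19)
      × (ZC1* T ≡ 2 * (5 * n ∸ 19) ⇔ (n % 3 ≡ 2 × (∀ u → deg T u ≡ 1 ⊎ deg T u ≡ 4)))
  two _ rewrite ≡.sym (second-bound 7≤n) = bound-0 , defect-0-iff ⇔-∘ exact-0
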